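{- A framed tableau $T$ of shape $\mu$ is a column-strict tableau of shape $\mu$ such that: (1) any two entries in the same column differ by at least $2$; (2) if $a\le b$ are entries in the same row of $T$ with $a$ to the left of $b$, then $b-a\le1$, unless the entry $d$ in the cell immediately above $a$ satisfies $d=a+2$.
   Context: For a partition $\mu=(\mu_1\ge\dots\ge\mu_r)$, $D_\mu=\{(i,j):1\le i\le r,1\le j\le\mu_i\}$, row $i$ counted from the bottom, so the cell above $(i,j)$ is $(i+1,j)$; a tableau is $T:D_\mu\to\mathbb{Z}_{>0}$, $t_{i,j}=T(i,j)$, $t_{i,j}=\infty$ off $D_\mu$; column-strict means $t_{i,j}<t_{i+1,j}$, $t_{i,j}\le t_{i,j+1}$. $\mathrm{Bcomp}(c,m)$ is the unique weakly increasing integer sequence of length $m$ with sum $c$ and max minus min at most $1$. $(\mu,s)$, $s=(s_1,\dots,s_r)$, satisfies the framing condition if $s_i\ge(2i-1)\mu_i$ for all $i$ and $s_{i+1}\ge s_i+2\mu_i$ whenever $\mu_{i+1}=\mu_i$. $\mathrm{Fram}(\mu,s)$ (with $\mu_{r+1}=0$): row $r$ is $\mathrm{Bcomp}(s_r,\mu_r)$; for $i=r-1$ down to $1$: $a=s_i$, $b=\mu_i$; for $k=r,\dots,i$: $(r_{i,\mu_{k+1}+1},\dots,r_{i,\mu_i})=\mathrm{Bcomp}(a,b)$; if $r_{i,j}\le t_{i+1,j}-2$ for all $\mu_{k+1}<j\le\mu_k$ set $t_{i,j}=r_{i,j}$ for these $j$, else $t_{i,j}=t_{i+1,j}-2$ for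 these $j$; then $a:=a-\sum_{\mu_{k+1}<j\le\mu_k}t_{i,j}$, $b:=b-(\mu_k-\mu_{k+1})$. A framed tableau is $\mathrm{Fram}(\mu,s)$ for some $(\mu,s)$ satisfying the framing condition. -}

module Defs where

open import Data.Bool using (Bool; true; false; if_then_else_; _∧_)
open import Data.Nat as ℕ using (ℕ; zero; suc; _∸_; ∣_-_∣)
open import Data.Integer as ℤ using (ℤ; +_; _/ℕ_; _%ℕ_)
open import Data.List using (List; []; _∷_; map; take; drop; replicate; _++_; reverse; length)
open import Data.List.Relation.Unary.All using (All)
open import Data.List.Relation.Unary.Linked using (Linked)
open import Data.Maybe using (Maybe; just; nothing; _>>=_)
open import Data.Product using (Σ; _×_)
open import Data.Sum using (_⊎_)
open import Data.Unit using (⊤)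
open import Relation.Binary.PropositionalEquality using (_≡_; _≢_)

-- Partitions and tableaux.
-- A partition μ = (μ₁ ≥ … ≥ μᵣ) is a list of positive naturals, weakly
-- decreasing; the head of the list is μ₁ (the bottom row).

IsPartition : List ℕ → Set
IsPartition μ = All (0 ℕ.<_) μ × Linked ℕ._≥_ μ

-- A tableau is given by its rows, bottom row first; row i has μᵢ entries.
-- It has shape μ and positive integer entries.
IsTableau : List ℕ → List (List ℕ) → Set
IsTableau μ T = map length T ≡ μ × All (All (0 ℕ.<_)) T

-- 1-indexed lookup (index 0 or out of range gives nothing).
at : {A : Set} → List A → ℕ → Maybe A
at [] _ = nothing
at (x ∷ xs) zero = nothing
at (x ∷ xs) (suc zero) = just x
at (x ∷ xs) (suc (suc n)) = at xs (suc n)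

-- t_{i,j}; nothing plays the role of ∞ (cells off D_μ).
entry : List (List ℕ) → ℕ → ℕ → Maybe ℕ
entry T i j = at T i >>= λ row → at row j

_<∞_ : ℕ → Maybe ℕ → Set
a <∞ nothing = ⊤
a <∞ just b = a ℕ.< b

_≤∞_ : ℕ → Maybe ℕ → Set
a ≤∞ nothing = ⊤
a ≤∞ just b = a ℕ.≤ b

ColumnStrict : List (List ℕ) → Set
ColumnStrict T = ∀ i j a → entry T i j ≡ just a →
  (a <∞ entry T (suc i) j) × (a ≤∞ entry T i (suc j))

ColumnGap : List (List ℕ) → Set
ColumnGap T = ∀ i i′ j a b → i ≢ i′ → entry T i j ≡ just a → entry T i′ j ≡ just b →
  2 ℕ.≤ ∣ a - b ∣

RowCondition : List (List ℕ) → Set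
RowCondition T = ∀ i j j′ a b → j ℕ.< j′ → entry T i j ≡ just a → entry T i j′ ≡ just b →
  a ℕ.≤ b → (b ∸ a ℕ.≤ 1) ⊎ (entry T (suc i) j ≡ just (a ℕ.+ 2))

-- Bcomp(c, m): weakly increasing, sum c, max - min ≤ 1 (floor division).

Bcomp : ℤ → ℕ → List ℤ
Bcomp c zero = []
Bcomp c (suc m) =
  replicate (suc m ∸ (c %ℕ suc m)) (c /ℕ suc m)
  ++ replicate (c %ℕ suc m) (c /ℕ suc m ℤ.+ ℤ.1ℤ)

sumℤ : List ℤ → ℤ
sumℤ [] = ℤ.0ℤ
sumℤ (x ∷ xs) = x ℤ.+ sumℤ xs

okAbove : List ℤ → List ℤ → Bool
okAbove [] _ = true
okAbove (r ∷ rs) [] = true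
okAbove (r ∷ rs) (t ∷ ts) = (r ℤ.≤ᵇ t ℤ.- + 2) ∧ okAbove rs ts

-- One step of the loop over k: 'a', 'b' as in the paper, the list of group
-- sizes μ_k - μ_{k+1} (k = r, …, i, i.e. left to right), and the remaining
-- part of row i+1 above the current group.
rowStep : ℤ → ℕ → List ℕ → List ℤ → List ℤ
rowStep a b [] above = []
rowStep a b (g ∷ gs) above =
  let rg = take g (Bcomp a b)
      ag = take g above
      tg = if okAbove rg ag then rg else map (λ t → t ℤ.- + 2) ag
  in tg ++ rowStep (a ℤ.- sumℤ tg) (b ∸ g) gs (drop g above)

diffs : List ℕ → List ℕ
diffs [] = []
diffs (x ∷ []) = x ∷ []
diffs (x ∷ y ∷ l) = (x ∸ y) ∷ diffs (y ∷ l)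

headRow : List (List ℤ) → List ℤ
headRow [] = []
headRow (r ∷ _) = r

-- Fram(μ, s), rows bottom first. Row r = Bcomp(s_r, μ_r) is the case of
-- the general step with no row above (all t_{r+1,j} = ∞).
Fram : List ℕ → List ℕ → List (List ℤ)
Fram [] _ = []
Fram (m ∷ ms) [] = []
Fram (m ∷ ms) (s ∷ ss) =
  let up = Fram ms ss
  in rowStep (+ s) m (reverse (diffs (m ∷ ms))) (headRow up) ∷ up

-- framing condition (indices 1-based)
FramingCondition : List ℕ → List ℕ → Set
FramingCondition μ s =
  length s ≡ length μ ×
  (∀ i m x → at μ i ≡ just m → at s i ≡ just x → (2 ℕ.* i ∸ 1) ℕ.* m ℕ.≤ x) ×
  (∀ i m x y → at μ i ≡ just m → at μ (suc i) ≡ just m → at s i ≡ just x →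
     at s (suc i) ≡ just y → x ℕ.+ 2 ℕ.* m ℕ.≤ y)

IsFramed : List ℕ → List (List ℕ) → Set
IsFramed μ T = Σ (List ℕ) λ s → FramingCondition μ s × Fram μ s ≡ map (map +_) T

module Submission where

-- Fram fills the rows from the top down.  Row i is built by rowStep from the
-- row u above it, group by group: each group is the next piece of the
-- balanced composition Bcomp of the remaining sum, unless that piece clashes
-- with u, in which case it is the part of u above it lowered by 2.  The core
-- is a characterisation of one row: if u is sorted with balanced groups, then
-- (rowStep-sound) rowStep yields a row admissible below u -- the row
-- condition holds and all column gaps are at least 2 -- and
-- (rowStep-complete) every admissible row below u of the prescribed length
-- and sum is the row rowStep yields.  Both rest on the rigidity of balanced
-- lists (they are determined by length and sum).  Iterating over the rows
-- gives Fram-sound and Fram-complete (with s the row sums); finally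
-- admissibility is translated into the index-based conditions of the
-- statement, and the framing condition is read off from the column gaps.

open import Defs
open import Data.Bool using (true; false; T)
open import Data.Nat as ℕ using (ℕ; zero; suc)
import Data.Nat.Properties as ℕP
open import Data.Integer as ℤ using (ℤ; +_; _+_; _-_; -_; _*_; _≤_; _<_; 1ℤ; _/ℕ_; _%ℕ_; _≤ᵇ_)
import Data.Integer.Properties as ℤP
open import Data.Integer.DivMod using (a≡a%ℕn+[a/ℕn]*n; n%ℕd<d)
open import Data.Integer.Tactic.RingSolver using (solve-∀)
import Data.Nat.Tactic.RingSolver as ℕSolver
open import Algebra.Properties.AbelianGroup ℤP.+-0-abelianGroup using (∙-cancelˡ)
open import Data.List using (List; []; _∷_; map; take; drop; replicate; _++_; reverse; length)
import Data.List.Properties as LP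
open import Data.List.Relation.Unary.All as All using (All; []; _∷_)
import Data.List.Relation.Unary.All.Properties as AllP
open import Data.List.Relation.Unary.AllPairs as AllPairs using (AllPairs; []; _∷_)
import Data.List.Relation.Unary.AllPairs.Properties as AllPairsP
open import Data.List.Relation.Unary.Any using (Any; here; there)
open import Data.List.Relation.Unary.Linked using (Linked; []; [-]; _∷_)
open import Data.Maybe as Maybe using (Maybe; just; nothing)
open import Data.Maybe.Properties using (just-injective)
open import Data.Product using (Σ; _×_; _,_; proj₁; proj₂)
open import Data.Sum using (_⊎_; inj₁; inj₂)
open import Data.Empty using (⊥; ⊥-elim)
open import Data.Unit using (⊤; tt)
open import Function using (_∘_)
open import Function.Bundles using (_⇔_; mk⇔)
open import Relation.Binary using (tri<; tri≈; tri>)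
open import Relation.Binary.PropositionalEquality
open import Relation.Nullary using (yes; no)

length-take : ∀ {A : Set} n (xs : List A) → n ℕ.≤ length xs → length (take n xs) ≡ n
length-take n xs n≤ = trans (LP.length-take n xs) (ℕP.m≤n⇒m⊓n≡m n≤)

sumℤ-++ : (xs ys : List ℤ) → sumℤ (xs ++ ys) ≡ sumℤ xs + sumℤ ys
sumℤ-++ [] ys = sym (ℤP.+-identityˡ _)
sumℤ-++ (x ∷ xs) ys = trans (cong (λ t → x + t) (sumℤ-++ xs ys)) (sym (ℤP.+-assoc x _ _))

sumℤ-replicate : ∀ n x → sumℤ (replicate n x) ≡ + n * x
sumℤ-replicate zero x = sym (ℤP.*-zeroˡ x)
sumℤ-replicate (suc n) x = trans (cong (λ t → x + t) (sumℤ-replicate n x)) (ring (+ n) x)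
  where
  ring : ∀ a x → x + a * x ≡ (1ℤ + a) * x
  ring = solve-∀

sumℤ-drop : ∀ g xs {a x} → sumℤ xs ≡ a → sumℤ (take g xs) ≡ x → sumℤ (drop g xs) ≡ a - x
sumℤ-drop g xs {a} {x} s t = begin
    sumℤ (drop g xs)                              ≡⟨ sym (ring (sumℤ (take g xs)) _) ⟩
    sumℤ (take g xs) + sumℤ (drop g xs) - sumℤ (take g xs)
      ≡⟨ cong (_- sumℤ (take g xs)) (sym (sumℤ-++ (take g xs) _)) ⟩
    sumℤ (take g xs ++ drop g xs) - sumℤ (take g xs)
      ≡⟨ cong₂ (λ l k → sumℤ l - k) (LP.take++drop≡id g xs) t ⟩
    sumℤ xs - x                                   ≡⟨ cong (_- x) s ⟩
    a - x ∎
  where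
  open ≡-Reasoning
  ring : ∀ x y → x + y - x ≡ y
  ring = solve-∀

sumℤ-mono : ∀ {c} (xs ys : List ℤ) → length xs ≡ length ys →
  All (_≤ c) xs → All (c ≤_) ys → sumℤ xs ≤ sumℤ ys
sumℤ-mono [] [] _ _ _ = ℤP.≤-refl
sumℤ-mono (x ∷ xs) (y ∷ ys) e (x≤c ∷ p) (c≤y ∷ q) =
  ℤP.+-mono-≤ (ℤP.≤-trans x≤c c≤y) (sumℤ-mono xs ys (ℕP.suc-injective e) p q)

sumℤ-strict : ∀ {c x y} (xs ys : List ℤ) → length xs ≡ length ys → x < y →
  All (_≤ c) xs → All (c ≤_) ys → sumℤ (x ∷ xs) < sumℤ (y ∷ ys)
sumℤ-strict xs ys e x<y p q = ℤP.+-mono-<-≤ x<y (sumℤ-mono xs ys e p q)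

<⇒+1≤ : ∀ {x y} → x < y → x + 1ℤ ≤ y
<⇒+1≤ {x} {y} p = subst (_≤ y) (ℤP.+-comm 1ℤ x) (ℤP.i<j⇒suc[i]≤j p)

<+1⇒≤ : ∀ {x y} → x < y + 1ℤ → x ≤ y
<+1⇒≤ {x} {y} p = subst (x ≤_) (ring y) (ℤP.i<j⇒i≤pred[j] p)
  where
  ring : ∀ y → - 1ℤ + (y + 1ℤ) ≡ y
  ring = solve-∀

Sorted : List ℤ → Set
Sorted = AllPairs _≤_

Near : ℤ → ℤ → Set
Near x y = x ≤ y × y ≤ x + 1ℤ

Balanced : List ℤ → Set
Balanced = AllPairs Near

Balanced⇒Sorted : ∀ {xs} → Balanced xs → Sorted xs
Balanced⇒Sorted = AllPairs.map proj₁

squeezed⇒Balanced : ∀ {m} {ys} → Sorted ys → All (m ≤_) ys → All (_≤ m + 1ℤ) ys → Balanced ys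
squeezed⇒Balanced [] _ _ = []
squeezed⇒Balanced (s ∷ ss) (m≤y ∷ lo) (_ ∷ hi) =
  All.zipWith (λ (p , q) → p , ℤP.≤-trans q (ℤP.+-monoˡ-≤ 1ℤ m≤y)) (s , hi) ∷ squeezed⇒Balanced ss lo hi

two-levels-balanced : ∀ n k q → Balanced (replicate n q ++ replicate k (q + 1ℤ))
two-levels-balanced (suc n) k q =
  AllP.++⁺ (AllP.replicate⁺ n (ℤP.≤-refl , ℤP.i≤i+j q 1ℤ))
           (AllP.replicate⁺ k (ℤP.i≤i+j q 1ℤ , ℤP.≤-refl))
  ∷ two-levels-balanced n k q
two-levels-balanced zero zero q = []
two-levels-balanced zero (suc k) q =
  AllP.replicate⁺ k (ℤP.≤-refl , ℤP.i≤i+j (q + 1ℤ) 1ℤ) ∷ two-levels-balanced zero k q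

Bcomp-balanced : ∀ c m → Balanced (Bcomp c m)
Bcomp-balanced c zero = []
Bcomp-balanced c (suc m) = two-levels-balanced (suc m ℕ.∸ c %ℕ suc m) (c %ℕ suc m) (c /ℕ suc m)

Bcomp-length : ∀ c m → length (Bcomp c m) ≡ m
Bcomp-length c zero = refl
Bcomp-length c (suc m) = begin
    length (replicate (suc m ℕ.∸ k) q ++ replicate k (q + 1ℤ))
  ≡⟨ LP.length-++ (replicate (suc m ℕ.∸ k) q) ⟩
    length (replicate (suc m ℕ.∸ k) q) ℕ.+ length (replicate k (q + 1ℤ))
  ≡⟨ cong₂ ℕ._+_ (LP.length-replicate (suc m ℕ.∸ k)) (LP.length-replicate k) ⟩
    (suc m ℕ.∸ k) ℕ.+ k
  ≡⟨ ℕP.m∸n+n≡m (ℕP.<⇒≤ (n%ℕd<d c (suc m))) ⟩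
    suc m ∎
  where
  open ≡-Reasoning
  k = c %ℕ suc m
  q = c /ℕ suc m

Bcomp-sum : ∀ c m → sumℤ (Bcomp c (suc m)) ≡ c
Bcomp-sum c m = begin
    sumℤ (replicate A q ++ replicate k (q + 1ℤ))
  ≡⟨ sumℤ-++ (replicate A q) _ ⟩
    sumℤ (replicate A q) + sumℤ (replicate k (q + 1ℤ))
  ≡⟨ cong₂ _+_ (sumℤ-replicate A q) (sumℤ-replicate k _) ⟩
    + A * q + + k * (q + 1ℤ)
  ≡⟨ ring (+ A) (+ k) q ⟩
    + k + q * (+ A + + k)
  ≡⟨ cong (λ t → + k + q * t) (sym (ℤP.pos-+ A k)) ⟩
    + k + q * + (A ℕ.+ k)
  ≡⟨ cong (λ t → + k + q * + t) (ℕP.m∸n+n≡m (ℕP.<⇒≤ (n%ℕd<d c (suc m)))) ⟩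
    + k + q * + suc m
  ≡⟨ sym (a≡a%ℕn+[a/ℕn]*n c (suc m)) ⟩
    c ∎
  where
  open ≡-Reasoning
  k = c %ℕ suc m
  q = c /ℕ suc m
  A = suc m ℕ.∸ k
  ring : ∀ a k q → a * q + k * (q + 1ℤ) ≡ k + q * (a + k)
  ring = solve-∀

Bcomp-sum-pos : ∀ c m → 0 ℕ.< m → sumℤ (Bcomp c m) ≡ c
Bcomp-sum-pos c (suc m) _ = Bcomp-sum c m

-- If some list of length m has sum c, then so does Bcomp c m (for m = 0 both sums vanish).
Bcomp-sum-of : ∀ c m (y : List ℤ) → length y ≡ m → sumℤ y ≡ c → sumℤ (Bcomp c m) ≡ c
Bcomp-sum-of c zero [] _ s = s
Bcomp-sum-of c (suc m) y _ _ = Bcomp-sum c m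

Tight : ℕ → List ℤ → List ℤ → Set
Tight zero _ _ = ⊤
Tight (suc g) (y ∷ ys) (r ∷ rs) = (y < r → All (_≤ y + 1ℤ) ys) × Tight g ys rs
Tight (suc g) _ _ = ⊤

-- A sorted list with the length and sum of a balanced list r that is tight
-- against r on its first g entries agrees with r there: comparing the first
-- differing entries, the tail bounds force a strict inequality of sums.
prefix-rigid : ∀ g y r → length y ≡ length r → sumℤ y ≡ sumℤ r → Balanced r → Sorted y →
  Tight g y r → take g y ≡ take g r
prefix-rigid zero y r _ _ _ _ _ = refl
prefix-rigid (suc g) [] [] _ _ _ _ _ = refl
prefix-rigid (suc g) (y ∷ ys) (r ∷ rs) e s (r≈ ∷ bal) (y≤ ∷ srt) (tight , tights)
  with ℤP.<-cmp y r
... | tri< y<r _ _ = ⊥-elim (ℤP.<⇒≢ sums< s)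
  where
  sums< : sumℤ (y ∷ ys) < sumℤ (r ∷ rs)
  sums< = sumℤ-strict ys rs (ℕP.suc-injective e) y<r
            (All.map (λ p → ℤP.≤-trans p (<⇒+1≤ y<r)) (tight y<r)) (All.map proj₁ r≈)
... | tri> _ _ r<y = ⊥-elim (ℤP.<⇒≢ sums< (sym s))
  where
  sums< : sumℤ (r ∷ rs) < sumℤ (y ∷ ys)
  sums< = sumℤ-strict rs ys (sym (ℕP.suc-injective e)) r<y
            (All.map (λ p → ℤP.≤-trans (proj₂ p) (<⇒+1≤ r<y)) r≈) y≤
... | tri≈ _ refl _ =
  cong (y ∷_) (prefix-rigid g ys rs (ℕP.suc-injective e) (∙-cancelˡ y _ _ s) bal srt tights)

Balanced⇒Tight : ∀ g y r → Balanced y → Tight g y r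
Balanced⇒Tight zero _ _ _ = tt
Balanced⇒Tight (suc g) [] _ _ = tt
Balanced⇒Tight (suc g) (y ∷ ys) [] _ = tt
Balanced⇒Tight (suc g) (y ∷ ys) (r ∷ rs) (y≈ ∷ bal) = (λ _ → All.map proj₂ y≈) , Balanced⇒Tight g ys rs bal

Balanced-unique : ∀ y r → length y ≡ length r → sumℤ y ≡ sumℤ r → Balanced y → Balanced r → y ≡ r
Balanced-unique y r e s by br = begin
    y                    ≡⟨ sym (LP.take-all (length y) y ℕP.≤-refl) ⟩
    take (length y) y    ≡⟨ prefix-rigid (length y) y r e s br (Balanced⇒Sorted by) (Balanced⇒Tight _ y r by) ⟩
    take (length y) r    ≡⟨ LP.take-all (length y) r (ℕP.≤-reflexive (sym e)) ⟩
    r ∎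
  where open ≡-Reasoning

Bcomp-drop : ∀ a b g → Bcomp (a - sumℤ (take g (Bcomp a b))) (b ℕ.∸ g) ≡ drop g (Bcomp a b)
Bcomp-drop a b g with b ℕ.∸ g in b-g
... | zero = sym (LP.drop-all g (Bcomp a b) (subst (ℕ._≤ g) (sym (Bcomp-length a b)) (ℕP.m∸n≡0⇒m≤n b-g)))
... | suc k = Balanced-unique _ _ len sum (Bcomp-balanced (a - sumℤ (take g r)) (suc k)) (AllPairsP.drop⁺ g (Bcomp-balanced a b))
  where
  r = Bcomp a b
  b-pos : 0 ℕ.< b
  b-pos = ℕP.≤-<-trans ℕ.z≤n (ℕP.m∸n≢0⇒n<m {b} {g} (λ e → ℕP.0≢1+n (trans (sym e) b-g)))
  len-drop : length (drop g r) ≡ suc k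
  len-drop = trans (LP.length-drop g r) (trans (cong (ℕ._∸ g) (Bcomp-length a b)) b-g)
  len : length (Bcomp (a - sumℤ (take g r)) (suc k)) ≡ length (drop g r)
  len = trans (Bcomp-length (a - sumℤ (take g r)) (suc k)) (sym len-drop)
  sum : sumℤ (Bcomp (a - sumℤ (take g r)) (suc k)) ≡ sumℤ (drop g r)
  sum = trans (Bcomp-sum (a - sumℤ (take g r)) k) (sym (sumℤ-drop g r (Bcomp-sum-pos a b b-pos) refl))

-- Among balanced lists of equal length, raising the sum preserves lower
-- bounds: the first entry cannot drop, since otherwise the sum would drop.
Balanced-lower-bound : ∀ {c} y z → length y ≡ length z → Balanced y → Balanced z →
  sumℤ z ≤ sumℤ y → All (c ≤_) z → All (c ≤_) y
Balanced-lower-bound [] [] _ _ _ _ _ = []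
Balanced-lower-bound (y ∷ ys) (z ∷ zs) e (y≈ ∷ _) (z≈ ∷ _) z≤y (c≤z ∷ _) =
  c≤y ∷ All.map (λ p → ℤP.≤-trans c≤y (proj₁ p)) y≈
  where
  head≤ : z ≤ y
  head≤ = ℤP.≮⇒≥ λ y<z → ℤP.<⇒≱ (sumℤ-strict ys zs (ℕP.suc-injective e) y<z
             (All.map (λ p → ℤP.≤-trans (proj₂ p) (<⇒+1≤ y<z)) y≈) (All.map proj₁ z≈)) z≤y
  c≤y : _ ≤ y
  c≤y = ℤP.≤-trans c≤z head≤

Bcomp-lower-bound : ∀ {c} a a′ b → a ≤ a′ → All (c ≤_) (Bcomp a b) → All (c ≤_) (Bcomp a′ b)
Bcomp-lower-bound a a′ zero _ _ = []
Bcomp-lower-bound a a′ (suc b) a≤a′ =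
  Balanced-lower-bound (Bcomp a′ (suc b)) (Bcomp a (suc b))
    (trans (Bcomp-length a′ (suc b)) (sym (Bcomp-length a (suc b))))
    (Bcomp-balanced a′ (suc b)) (Bcomp-balanced a (suc b))
    (subst₂ _≤_ (sym (Bcomp-sum a b)) (sym (Bcomp-sum a′ b)) a≤a′)

-- An entry together with the entry directly above it (nothing plays ∞).
Cell : Set
Cell = ℤ × Maybe ℤ

withAbove : List ℤ → List ℤ → List Cell
withAbove [] _ = []
withAbove (x ∷ xs) [] = (x , nothing) ∷ withAbove xs []
withAbove (x ∷ xs) (u ∷ us) = (x , just u) ∷ withAbove xs us

two : ℤ
two = + 2

RowPair : Cell → ℤ → Set
RowPair (a , d) b = a ≤ b × (b ≤ a + 1ℤ ⊎ d ≡ just (a + two))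

RowRel : Cell → Cell → Set
RowRel c (b , _) = RowPair c b

GapAbove : Cell → Set
GapAbove (a , nothing) = ⊤
GapAbove (a , just d) = a + two ≤ d

Admissible : List ℤ → List ℤ → Set
Admissible x u = AllPairs RowRel (withAbove x u) × All GapAbove (withAbove x u)

BlocksBalanced : List ℕ → List ℤ → Set
BlocksBalanced [] u = ⊤
BlocksBalanced (g ∷ gs) u = Balanced (take g u) × BlocksBalanced gs (drop g u)

sumℕ : List ℕ → ℕ
sumℕ [] = 0
sumℕ (x ∷ xs) = x ℕ.+ sumℕ xs

withAbove-++ : ∀ g xs ys u → length xs ≡ g →
  withAbove (xs ++ ys) u ≡ withAbove xs (take g u) ++ withAbove ys (drop g u)
withAbove-++ _ [] ys u refl = refl
withAbove-++ _ (x ∷ xs) ys [] refl = cong ((x , nothing) ∷_)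
  (trans (withAbove-++ _ xs ys [] refl)
         (cong₂ (λ p q → withAbove xs p ++ withAbove ys q) (LP.take-[] (length xs)) (LP.drop-[] (length xs))))
withAbove-++ _ (x ∷ xs) ys (u ∷ us) refl = cong ((x , just u) ∷_) (withAbove-++ _ xs ys us refl)

withAbove-drop : ∀ g y u → drop g (withAbove y u) ≡ withAbove (drop g y) (drop g u)
withAbove-drop zero y u = refl
withAbove-drop (suc g) [] u = refl
withAbove-drop (suc g) (x ∷ y) [] = trans (withAbove-drop g y []) (cong (withAbove (drop g y)) (LP.drop-[] g))
withAbove-drop (suc g) (x ∷ y) (w ∷ u) = withAbove-drop g y u

Admissible-drop : ∀ g y u → Admissible y u → Admissible (drop g y) (drop g u)
Admissible-drop g y u (pairs , gaps) rewrite sym (withAbove-drop g y u) =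
  AllPairsP.drop⁺ g pairs , AllP.drop⁺ g gaps

All-withAbove : ∀ {P : Cell → Set} {Q : ℤ → Set} → (∀ {c} → P c → Q (proj₁ c)) →
  ∀ x u → All P (withAbove x u) → All Q x
All-withAbove f [] u p = []
All-withAbove f (x ∷ xs) [] (px ∷ p) = f px ∷ All-withAbove f xs [] p
All-withAbove f (x ∷ xs) (_ ∷ u) (px ∷ p) = f px ∷ All-withAbove f xs u p

withAbove-All : ∀ {P : ℤ → Set} {Q : Cell → Set} → (∀ {c} → P (proj₁ c) → Q c) →
  ∀ x u → All P x → All Q (withAbove x u)
withAbove-All f [] u p = []
withAbove-All f (x ∷ xs) [] (px ∷ p) = f px ∷ withAbove-All f xs [] p
withAbove-All f (x ∷ xs) (_ ∷ u) (px ∷ p) = f px ∷ withAbove-All f xs u p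

Admissible⇒Sorted : ∀ y u → Admissible y u → Sorted y
Admissible⇒Sorted [] u _ = []
Admissible⇒Sorted (y ∷ ys) [] (p ∷ ps , _ ∷ gs) =
  All-withAbove proj₁ ys [] p ∷ Admissible⇒Sorted ys [] (ps , gs)
Admissible⇒Sorted (y ∷ ys) (_ ∷ u) (p ∷ ps , _ ∷ gs) =
  All-withAbove proj₁ ys u p ∷ Admissible⇒Sorted ys u (ps , gs)

Balanced⇒RowPairs : ∀ xs us → Balanced xs → AllPairs RowRel (withAbove xs us)
Balanced⇒RowPairs [] us _ = []
Balanced⇒RowPairs (x ∷ xs) [] (a ∷ s) =
  withAbove-All (λ (p , q) → p , inj₁ q) xs [] a ∷ Balanced⇒RowPairs xs [] s
Balanced⇒RowPairs (x ∷ xs) (u ∷ us) (a ∷ s) =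
  withAbove-All (λ (p , q) → p , inj₁ q) xs us a ∷ Balanced⇒RowPairs xs us s

-- The largest entry allowed directly below t.
under : ℤ → ℤ
under t = t - two

under-+2 : ∀ t → under t + two ≡ t
under-+2 = ring
  where
  ring : ∀ t → t - + 2 + + 2 ≡ t
  ring = solve-∀

+2-under : ∀ a → under (a + two) ≡ a
+2-under = ring
  where
  ring : ∀ a → a + + 2 - + 2 ≡ a
  ring = solve-∀

≤under⇒+2≤ : ∀ {a t} → a ≤ under t → a + two ≤ t
≤under⇒+2≤ {a} {t} p = subst (a + two ≤_) (under-+2 t) (ℤP.+-monoˡ-≤ two p)

+2≤⇒≤under : ∀ {a t} → a + two ≤ t → a ≤ under t
+2≤⇒≤under {a} {t} p = subst (_≤ under t) (+2-under a) (ℤP.+-monoˡ-≤ (- two) p)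

Fits : List ℤ → List ℤ → Set
Fits (r ∷ rs) (t ∷ ts) = r ≤ under t × Fits rs ts
Fits _ _ = ⊤

Clash : List ℤ → List ℤ → Set
Clash (r ∷ rs) (t ∷ ts) = under t < r ⊎ Clash rs ts
Clash _ _ = ⊥

okAbove-true⇒Fits : ∀ rs ts → okAbove rs ts ≡ true → Fits rs ts
okAbove-true⇒Fits [] ts e = tt
okAbove-true⇒Fits (r ∷ rs) [] e = tt
okAbove-true⇒Fits (r ∷ rs) (t ∷ ts) e with r ≤ᵇ under t in fits
... | true = ℤP.≤ᵇ⇒≤ (subst T (sym fits) tt) , okAbove-true⇒Fits rs ts e

okAbove-false⇒Clash : ∀ rs ts → okAbove rs ts ≡ false → Clash rs ts
okAbove-false⇒Clash (r ∷ rs) (t ∷ ts) e with r ≤ᵇ under t in fits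
... | true = inj₂ (okAbove-false⇒Clash rs ts e)
... | false = inj₁ (ℤP.≰⇒> (λ le → subst T fits (ℤP.≤⇒≤ᵇ le)))

okAbove-[] : ∀ rs n → okAbove rs (take n []) ≡ true
okAbove-[] [] n = refl
okAbove-[] (r ∷ rs) zero = refl
okAbove-[] (r ∷ rs) (suc n) = refl

data StepView (a : ℤ) (b g : ℕ) (gs : List ℕ) (u : List ℤ) : Set where
  fits : okAbove (take g (Bcomp a b)) (take g u) ≡ true →
    rowStep a b (g ∷ gs) u ≡
      take g (Bcomp a b) ++ rowStep (a - sumℤ (take g (Bcomp a b))) (b ℕ.∸ g) gs (drop g u) →
    StepView a b g gs u
  clashes : okAbove (take g (Bcomp a b)) (take g u) ≡ false →
    rowStep a b (g ∷ gs) u ≡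
      map under (take g u) ++ rowStep (a - sumℤ (map under (take g u))) (b ℕ.∸ g) gs (drop g u) →
    StepView a b g gs u

rowStep-fits : ∀ a b g gs u → okAbove (take g (Bcomp a b)) (take g u) ≡ true →
  rowStep a b (g ∷ gs) u ≡
    take g (Bcomp a b) ++ rowStep (a - sumℤ (take g (Bcomp a b))) (b ℕ.∸ g) gs (drop g u)
rowStep-fits a b g gs u ok rewrite ok = refl

rowStep-clashes : ∀ a b g gs u → okAbove (take g (Bcomp a b)) (take g u) ≡ false →
  rowStep a b (g ∷ gs) u ≡
    map under (take g u) ++ rowStep (a - sumℤ (map under (take g u))) (b ℕ.∸ g) gs (drop g u)
rowStep-clashes a b g gs u ok rewrite ok = refl

stepView : ∀ a b g gs u → StepView a b g gs u
stepView a b g gs u with okAbove (take g (Bcomp a b)) (take g u) in ok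
... | true = fits ok (rowStep-fits a b g gs u ok)
... | false = clashes ok (rowStep-clashes a b g gs u ok)

Undercut : List ℤ → List ℤ → Set
Undercut (v ∷ vs) (r ∷ rs) = v < r ⊎ Undercut vs rs
Undercut _ _ = ⊥

PrefixLe : List ℤ → List ℤ → Set
PrefixLe [] _ = ⊤
PrefixLe (v ∷ vs) [] = ⊥
PrefixLe (v ∷ vs) (r ∷ rs) = v ≤ r × PrefixLe vs rs

separated⇒PrefixLe : ∀ {c} vs rs → length vs ℕ.≤ length rs → All (_≤ c) vs → All (c ≤_) rs → PrefixLe vs rs
separated⇒PrefixLe [] rs _ _ _ = tt
separated⇒PrefixLe (v ∷ vs) (r ∷ rs) (ℕ.s≤s le) (v≤c ∷ p) (c≤r ∷ q) =
  ℤP.≤-trans v≤c c≤r , separated⇒PrefixLe vs rs le p q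

PrefixLe⇒sum : ∀ v r → PrefixLe v r → sumℤ v ≤ sumℤ (take (length v) r)
PrefixLe⇒sum [] r _ = ℤP.≤-refl
PrefixLe⇒sum (v ∷ vs) (r ∷ rs) (v≤r , p) = ℤP.+-mono-≤ v≤r (PrefixLe⇒sum vs rs p)

-- If a balanced v undercuts a balanced r, then v lies entrywise below r and
-- some entry M of r separates v from the part of r beyond v.  (The witnesses
-- of M in r and of an entry of v below M drive the induction.)
undercut-bounds : ∀ v r → length v ℕ.≤ length r → Balanced v → Balanced r → Undercut v r →
  PrefixLe v r × Σ ℤ (λ M → All (_≤ M) v × All (M ≤_) (drop (length v) r) × Any (M ≡_) r × Any (_< M) v)
undercut-bounds (w ∷ ws) (r ∷ rs) (ℕ.s≤s le) (w≈ ∷ _) (r≈ ∷ _) (inj₁ w<r) =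
  (ℤP.<⇒≤ w<r , separated⇒PrefixLe ws rs le ws≤r (All.map proj₁ r≈)) ,
  r , ℤP.<⇒≤ w<r ∷ ws≤r , AllP.drop⁺ (length ws) (All.map proj₁ r≈) , here refl , here w<r
  where
  ws≤r : All (_≤ r) ws
  ws≤r = All.map (λ p → ℤP.≤-trans (proj₂ p) (<⇒+1≤ w<r)) w≈
undercut-bounds (w ∷ ws) (r ∷ rs) (ℕ.s≤s le) (w≈ ∷ bw) (r≈ ∷ br) (inj₂ cut)
  with undercut-bounds ws rs le bw br cut
... | pw , M , ws≤M , M≤rest , M∈rs , some<M =
  (w≤r , pw) , M , ℤP.<⇒≤ w<M ∷ ws≤M , M≤rest , there M∈rs , there some<M
  where
  M≤r+1 : M ≤ r + 1ℤ
  M≤r+1 = let (r≤x , x≤r+1) , M≡x = All.lookupAny r≈ M∈rs in subst (_≤ r + 1ℤ) (sym M≡x) x≤r+1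
  w<M : w < M
  w<M = let (w≤x , _) , x<M = All.lookupAny w≈ some<M in ℤP.≤-<-trans w≤x x<M
  w≤r : w ≤ r
  w≤r = <+1⇒≤ (ℤP.<-≤-trans w<M M≤r+1)

Clash⇒Undercut : ∀ g rs ts → Clash (take g rs) ts → Undercut (map under ts) rs
Clash⇒Undercut (suc g) (r ∷ rs) (t ∷ ts) (inj₁ x) = inj₁ x
Clash⇒Undercut (suc g) (r ∷ rs) (t ∷ ts) (inj₂ y) = inj₂ (Clash⇒Undercut g rs ts y)

Balanced-under : ∀ {xs} → Balanced xs → Balanced (map under xs)
Balanced-under = AllPairsP.map⁺ ∘ AllPairs.map λ {x} (p , q) →
  ℤP.+-monoˡ-≤ (- two) p , ℤP.≤-trans (ℤP.+-monoˡ-≤ (- two) q) (ℤP.≤-reflexive (ring x))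
  where
  ring : ∀ x → x + 1ℤ - + 2 ≡ x - + 2 + 1ℤ
  ring = solve-∀

-- When a block of Bcomp clashes with the row above, its replacement (the row
-- above lowered by two) is entrywise smaller, so more sum remains for the
-- rest of the row; and some M separates the replacement from the rest of Bcomp.
clash-bounds : ∀ a b g u → g ℕ.≤ b → g ℕ.≤ length u → Balanced (take g u) →
  okAbove (take g (Bcomp a b)) (take g u) ≡ false →
  (a - sumℤ (take g (Bcomp a b)) ≤ a - sumℤ (map under (take g u))) ×
  Σ ℤ (λ M → All (_≤ M) (map under (take g u)) × All (M ≤_) (drop g (Bcomp a b)))
clash-bounds a b g u g≤b g≤u bal ok with
  undercut-bounds v r len≤ (Balanced-under bal) (Bcomp-balanced a b)
    (Clash⇒Undercut g r (take g u) (okAbove-false⇒Clash _ _ ok))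
  where
  v = map under (take g u)
  r = Bcomp a b
  len≤ : length v ℕ.≤ length r
  len≤ = subst₂ ℕ._≤_ (sym (trans (LP.length-map under (take g u)) (length-take g u g≤u)))
           (sym (Bcomp-length a b)) g≤b
... | pw , M , v≤M , M≤rest , _ , _ =
  ℤP.+-monoʳ-≤ a (ℤP.neg-mono-≤ sum≤) , M , v≤M , subst (λ k → All (M ≤_) (drop k (Bcomp a b))) len-v M≤rest
  where
  len-v : length (map under (take g u)) ≡ g
  len-v = trans (LP.length-map under (take g u)) (length-take g u g≤u)
  sum≤ : sumℤ (map under (take g u)) ≤ sumℤ (take g (Bcomp a b))
  sum≤ = subst (λ k → sumℤ (map under (take g u)) ≤ sumℤ (take k (Bcomp a b))) len-v (PrefixLe⇒sum _ _ pw)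

rowStep-last : ∀ a b d → rowStep a b (d ∷ []) [] ≡ take d (Bcomp a b)
rowStep-last a b d =
  trans (rowStep-fits a b d [] [] (okAbove-[] (take d (Bcomp a b)) d)) (LP.++-identityʳ _)

∸-group : ∀ g S d b → b ≡ (g ℕ.+ S) ℕ.+ d → b ℕ.∸ g ≡ S ℕ.+ d
∸-group g S d b refl = trans (cong (ℕ._∸ g) (ℕP.+-assoc g S d)) (ℕP.m+n∸m≡n g (S ℕ.+ d))

group≤ : ∀ g S d b → b ≡ (g ℕ.+ S) ℕ.+ d → g ℕ.≤ b
group≤ g S d b refl = ℕP.≤-trans (ℕP.m≤m+n g S) (ℕP.m≤m+n (g ℕ.+ S) d)

length-drop-group : ∀ g S (u : List ℤ) → length u ≡ g ℕ.+ S → length (drop g u) ≡ S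
length-drop-group g S u e = trans (LP.length-drop g u) (trans (cong (ℕ._∸ g) e) (ℕP.m+n∸m≡n g S))

group≤length : ∀ g S (u : List ℤ) → length u ≡ g ℕ.+ S → g ℕ.≤ length u
group≤length g S u e = subst (g ℕ.≤_) (sym e) (ℕP.m≤m+n g S)

-- A lower bound c on Bcomp persists in the constructed row, provided the row
-- above stays two above c: fitting blocks come from Bcomp, replaced blocks
-- from the row above, and a replacement only raises the remaining sum.
rowStep-lower-bound : ∀ gs d a b u c → b ≡ sumℕ gs ℕ.+ d → length u ≡ sumℕ gs → BlocksBalanced gs u →
  All (c ≤_) (Bcomp a b) → All (λ w → c + two ≤ w) u → All (c ≤_) (rowStep a b (gs ++ d ∷ []) u)
rowStep-lower-bound [] d a b [] c eb eu _ c≤r _ rewrite rowStep-last a b d = AllP.take⁺ d c≤r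
rowStep-lower-bound (g ∷ gs) d a b u c eb eu (bal , bals) c≤r c+2≤u with stepView a b g (gs ++ d ∷ []) u
... | fits _ eq rewrite eq =
  AllP.++⁺ (AllP.take⁺ g c≤r) (rowStep-lower-bound gs d _ _ (drop g u) c eb′ eu′ bals c≤rest (AllP.drop⁺ g c+2≤u))
  where
  eb′ = ∸-group g (sumℕ gs) d b eb
  eu′ = length-drop-group g (sumℕ gs) u eu
  c≤rest = subst (All (c ≤_)) (sym (Bcomp-drop a b g)) (AllP.drop⁺ g c≤r)
... | clashes ok eq rewrite eq =
  AllP.++⁺ (AllP.map⁺ (AllP.take⁺ g (All.map +2≤⇒≤under c+2≤u)))
    (rowStep-lower-bound gs d _ _ (drop g u) c eb′ eu′ bals c≤rest (AllP.drop⁺ g c+2≤u))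
  where
  eb′ = ∸-group g (sumℕ gs) d b eb
  eu′ = length-drop-group g (sumℕ gs) u eu
  more-left = proj₁ (clash-bounds a b g u (group≤ g (sumℕ gs) d b eb) (group≤length g (sumℕ gs) u eu) bal ok)
  c≤rest = Bcomp-lower-bound _ _ (b ℕ.∸ g) more-left
             (subst (All (c ≤_)) (sym (Bcomp-drop a b g)) (AllP.drop⁺ g c≤r))

-- An upper bound c on Bcomp two below the row above: nothing clashes, so
-- the row is taken from Bcomp and stays below c.
rowStep-upper-bound : ∀ gs d a b u c → b ≡ sumℕ gs ℕ.+ d → length u ≡ sumℕ gs →
  All (_≤ c) (Bcomp a b) → All (λ w → c + two ≤ w) u → All (_≤ c) (rowStep a b (gs ++ d ∷ []) u)
rowStep-upper-bound [] d a b [] c eb eu r≤c _ rewrite rowStep-last a b d = AllP.take⁺ d r≤c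
rowStep-upper-bound (g ∷ gs) d a b u c eb eu r≤c c+2≤u with stepView a b g (gs ++ d ∷ []) u
... | fits _ eq rewrite eq =
  AllP.++⁺ (AllP.take⁺ g r≤c)
    (rowStep-upper-bound gs d _ _ (drop g u) c (∸-group g (sumℕ gs) d b eb) (length-drop-group g (sumℕ gs) u eu)
       (subst (All (_≤ c)) (sym (Bcomp-drop a b g)) (AllP.drop⁺ g r≤c)) (AllP.drop⁺ g c+2≤u))
... | clashes ok _ = ⊥-elim (no-clash (take g (Bcomp a b)) (take g u)
        (okAbove-false⇒Clash _ _ ok) (AllP.take⁺ g r≤c) (AllP.take⁺ g c+2≤u))
  where
  no-clash : ∀ rs ts → Clash rs ts → All (_≤ c) rs → All (λ w → c + two ≤ w) ts → ⊥
  no-clash (r ∷ rs) (t ∷ ts) (inj₁ t<r) (r≤c ∷ _) (c+2≤t ∷ _) =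
    ℤP.<-irrefl refl (ℤP.≤-<-trans (+2≤⇒≤under c+2≤t) (ℤP.<-≤-trans t<r r≤c))
  no-clash (r ∷ rs) (t ∷ ts) (inj₂ cl) (_ ∷ p) (_ ∷ q) = no-clash rs ts cl p q

AllPairs-take-drop : ∀ {R : ℤ → ℤ → Set} g {xs} → AllPairs R xs → All (λ x → All (R x) (drop g xs)) (take g xs)
AllPairs-take-drop zero _ = []
AllPairs-take-drop (suc g) [] = []
AllPairs-take-drop (suc g) (px ∷ pxs) = AllP.drop⁺ g px ∷ AllPairs-take-drop g pxs

withAbove-fits : ∀ {P Q : ℤ → Set} {R : Cell → Set} → (∀ {x w} → P x → Q w → x ≤ under w → R (x , just w)) →
  ∀ xs us → length xs ℕ.≤ length us → All P xs → All Q us → Fits xs us → All R (withAbove xs us)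
withAbove-fits h [] us _ _ _ _ = []
withAbove-fits h (x ∷ xs) (u ∷ us) (ℕ.s≤s le) (px ∷ p) (qu ∷ q) (fx , ft) = h px qu fx ∷ withAbove-fits h xs us le p q ft

withAbove-under : ∀ ts → withAbove (map under ts) ts ≡ map (λ t → under t , just t) ts
withAbove-under [] = refl
withAbove-under (t ∷ ts) = cong ((under t , just t) ∷_) (withAbove-under ts)

-- The row above lowered by two is admissible below it: each entry sits exactly two below its neighbour above.
under-admissible : ∀ ts → Sorted ts → Admissible (map under ts) ts
under-admissible ts s rewrite withAbove-under ts = pairs ts s , AllP.map⁺ (All.tabulate λ {t} _ → ℤP.≤-reflexive (under-+2 t))
  where
  pairs : ∀ ts → Sorted ts → AllPairs RowRel (map (λ t → under t , just t) ts)
  pairs [] [] = []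
  pairs (t ∷ ts) (t≤ ∷ s) =
    AllP.map⁺ (All.map (λ t≤t′ → ℤP.+-monoˡ-≤ (- two) t≤t′ , inj₂ (cong just (sym (under-+2 t)))) t≤) ∷ pairs ts s

RowInvariant : List ℕ → List ℤ → ℕ → List ℤ → Set
RowInvariant gs x b u = Admissible x u × length x ≡ b × BlocksBalanced gs x

take-++ : ∀ {A : Set} g (xs ys : List A) → length xs ≡ g → take g (xs ++ ys) ≡ xs
take-++ _ [] ys refl = refl
take-++ _ (x ∷ xs) ys refl = cong (x ∷_) (take-++ _ xs ys refl)

drop-++ : ∀ {A : Set} g (xs ys : List A) → length xs ≡ g → drop g (xs ++ ys) ≡ ys
drop-++ _ [] ys refl = refl
drop-++ _ (x ∷ xs) ys refl = drop-++ _ xs ys refl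

glue : ∀ g gs y X b u → g ℕ.≤ b → length y ≡ g → Balanced y → Admissible y (take g u) →
  All (λ c → All (RowPair c) X) (withAbove y (take g u)) →
  RowInvariant gs X (b ℕ.∸ g) (drop g u) → RowInvariant (g ∷ gs) (y ++ X) b u
glue g gs y X b u g≤b len bal (pairs , gaps) cross ((pairs′ , gaps′) , len′ , blocks) =
  admissible , length-y++X , blocks-y++X
  where
  admissible : Admissible (y ++ X) u
  admissible rewrite withAbove-++ g y X u len =
    AllPairsP.++⁺ pairs pairs′ (All.map (withAbove-All (λ p → p) X (drop g u)) cross) , AllP.++⁺ gaps gaps′
  length-y++X : length (y ++ X) ≡ b
  length-y++X = trans (LP.length-++ y) (trans (cong₂ ℕ._+_ len len′) (ℕP.m+[n∸m]≡n g≤b))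
  blocks-y++X : BlocksBalanced (g ∷ gs) (y ++ X)
  blocks-y++X rewrite take-++ g y X len | drop-++ g y X len = bal , blocks

module RowStep (g : ℕ) (gs : List ℕ) (d : ℕ) (a : ℤ) (b : ℕ) (u : List ℤ)
  (eb : b ≡ (g ℕ.+ sumℕ gs) ℕ.+ d) (eu : length u ≡ g ℕ.+ sumℕ gs)
  (sorted : Sorted u) (bals : BlocksBalanced (g ∷ gs) u) where

  r : List ℤ
  r = Bcomp a b

  g≤b : g ℕ.≤ b
  g≤b = group≤ g (sumℕ gs) d b eb

  g≤u : g ℕ.≤ length u
  g≤u = group≤length g (sumℕ gs) u eu

  b′ : ℕ
  b′ = b ℕ.∸ g

  eb′ : b′ ≡ sumℕ gs ℕ.+ d
  eb′ = ∸-group g (sumℕ gs) d b eb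

  eu′ : length (drop g u) ≡ sumℕ gs
  eu′ = length-drop-group g (sumℕ gs) u eu

  rest : ℤ → List ℤ
  rest a′ = rowStep a′ b′ (gs ++ d ∷ []) (drop g u)

  u-rest : All (λ w → All (w ≤_) (drop g u)) (take g u)
  u-rest = AllPairs-take-drop g sorted

  fitted-lower : ∀ {x w} → All (Near x) (drop g r) → All (w ≤_) (drop g u) → x ≤ under w →
    All (x ≤_) (rest (a - sumℤ (take g r)))
  fitted-lower {x} x≈rest w≤rest x≤w-2 =
    rowStep-lower-bound gs d _ b′ (drop g u) x eb′ eu′ (proj₂ bals)
      (subst (All (x ≤_)) (sym (Bcomp-drop a b g)) (All.map proj₁ x≈rest))
      (All.map (ℤP.≤-trans (≤under⇒+2≤ x≤w-2)) w≤rest)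

  fitted-cross : ∀ {x w} → All (Near x) (drop g r) → All (w ≤_) (drop g u) → x ≤ under w →
    All (RowPair (x , just w)) (rest (a - sumℤ (take g r)))
  fitted-cross {x} {w} x≈rest w≤rest x≤w-2 with w ℤP.≟ x + two
  ... | yes w≡ = All.map (λ le → le , inj₂ (cong just w≡)) (fitted-lower x≈rest w≤rest x≤w-2)
  ... | no w≢ = All.zipWith (λ (le , up) → le , inj₁ up) (fitted-lower x≈rest w≤rest x≤w-2 , upper)
    where
    x+3≤w : x + 1ℤ + two ≤ w
    x+3≤w = subst (_≤ w) (ring x) (<⇒+1≤ (ℤP.≤∧≢⇒< (≤under⇒+2≤ x≤w-2) (w≢ ∘ sym)))
      where
      ring : ∀ x → x + + 2 + 1ℤ ≡ x + 1ℤ + + 2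
      ring = solve-∀
    upper = rowStep-upper-bound gs d _ b′ (drop g u) (x + 1ℤ) eb′ eu′
              (subst (All (_≤ x + 1ℤ)) (sym (Bcomp-drop a b g)) (All.map proj₂ x≈rest))
              (All.map (ℤP.≤-trans x+3≤w) w≤rest)

  fits-step : okAbove (take g r) (take g u) ≡ true →
    RowInvariant (gs ++ d ∷ []) (rest (a - sumℤ (take g r))) b′ (drop g u) →
    RowInvariant (g ∷ gs ++ d ∷ []) (take g r ++ rest (a - sumℤ (take g r))) b u
  fits-step ok =
    glue g (gs ++ d ∷ []) (take g r) _ b u g≤b len-block block-balanced
      (Balanced⇒RowPairs _ _ block-balanced , gaps)
      (withAbove-fits fitted-cross (take g r) (take g u) len≤
         (AllPairs-take-drop g (Bcomp-balanced a b)) u-rest fitting)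
    where
    len-block : length (take g r) ≡ g
    len-block = length-take g r (subst (g ℕ.≤_) (sym (Bcomp-length a b)) g≤b)
    len≤ : length (take g r) ℕ.≤ length (take g u)
    len≤ = subst₂ ℕ._≤_ (sym len-block) (sym (length-take g u g≤u)) ℕP.≤-refl
    block-balanced = AllPairsP.take⁺ g (Bcomp-balanced a b)
    fitting = okAbove-true⇒Fits _ _ ok
    gaps = withAbove-fits {P = λ _ → ⊤} {Q = λ _ → ⊤} (λ _ _ → ≤under⇒+2≤) (take g r) (take g u) len≤
             (All.tabulate λ _ → tt) (All.tabulate λ _ → tt) fitting

  clash-step : okAbove (take g r) (take g u) ≡ false →
    RowInvariant (gs ++ d ∷ []) (rest (a - sumℤ (map under (take g u)))) b′ (drop g u) →
    RowInvariant (g ∷ gs ++ d ∷ []) (map under (take g u) ++ rest (a - sumℤ (map under (take g u)))) b u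
  clash-step ok =
    glue g (gs ++ d ∷ []) (map under (take g u)) _ b u g≤b len-block (Balanced-under (proj₁ bals))
      (under-admissible (take g u) (AllPairsP.take⁺ g sorted))
      (subst (All (λ c → All (RowPair c) X)) (sym (withAbove-under (take g u)))
         (AllP.map⁺ (All.zipWith replaced-cross (v≤M , u-rest))))
    where
    len-block : length (map under (take g u)) ≡ g
    len-block = trans (LP.length-map under (take g u)) (length-take g u g≤u)
    X = rest (a - sumℤ (map under (take g u)))
    bounds = clash-bounds a b g u g≤b g≤u (proj₁ bals) ok
    M = proj₁ (proj₂ bounds)
    v≤M : All (λ t → under t ≤ M) (take g u)
    v≤M = AllP.map⁻ (proj₁ (proj₂ (proj₂ bounds)))
    replaced-cross : ∀ {t} → under t ≤ M × All (t ≤_) (drop g u) → All (RowPair (under t , just t)) X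
    replaced-cross {t} (t-2≤M , t≤rest) = All.map (λ le → le , inj₂ (cong just (sym (under-+2 t)))) lower
      where
      lower = rowStep-lower-bound gs d _ b′ (drop g u) (under t) eb′ eu′ (proj₂ bals)
                (Bcomp-lower-bound _ _ b′ (proj₁ bounds)
                   (subst (All (under t ≤_)) (sym (Bcomp-drop a b g))
                      (All.map (ℤP.≤-trans t-2≤M) (proj₂ (proj₂ (proj₂ bounds))))))
                (All.map (ℤP.≤-trans (ℤP.≤-reflexive (under-+2 t))) t≤rest)

nothing-above : ∀ xs → All GapAbove (withAbove xs [])
nothing-above [] = []
nothing-above (x ∷ xs) = tt ∷ nothing-above xs

rowStep-sound : ∀ gs d a b u → b ≡ sumℕ gs ℕ.+ d → length u ≡ sumℕ gs → Sorted u → BlocksBalanced gs u →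
  RowInvariant (gs ++ d ∷ []) (rowStep a b (gs ++ d ∷ []) u) b u
rowStep-sound [] d a b [] eb _ _ _ rewrite rowStep-last a b d =
  (Balanced⇒RowPairs _ [] bal , nothing-above _) , len , AllPairsP.take⁺ d bal , tt
  where
  bal = AllPairsP.take⁺ d (Bcomp-balanced a b)
  len : length (take d (Bcomp a b)) ≡ b
  len = trans (length-take d (Bcomp a b) (ℕP.≤-reflexive (trans (sym eb) (sym (Bcomp-length a b))))) (sym eb)
rowStep-sound (g ∷ gs) d a b u eb eu sorted bals with stepView a b g (gs ++ d ∷ []) u
... | fits ok eq rewrite eq = fits-step ok (rowStep-sound gs d _ b′ (drop g u) eb′ eu′ (AllPairsP.drop⁺ g sorted) (proj₂ bals))
  where open RowStep g gs d a b u eb eu sorted bals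
... | clashes ok eq rewrite eq = clash-step ok (rowStep-sound gs d _ b′ (drop g u) eb′ eu′ (AllPairsP.drop⁺ g sorted) (proj₂ bals))
  where open RowStep g gs d a b u eb eu sorted bals

RowRel⇒window : ∀ {x d} ys w → (∀ {e} → d ≡ just e → e ≢ x + two) →
  All (RowRel (x , d)) (withAbove ys w) → All (_≤ x + 1ℤ) ys
RowRel⇒window {x} {d} ys w not-tight = All-withAbove window ys w
  where
  window : ∀ {y} → RowPair (x , d) y → y ≤ x + 1ℤ
  window (_ , inj₁ y≤) = y≤
  window (_ , inj₂ tight) = ⊥-elim (not-tight tight refl)

Admissible[]⇒Balanced : ∀ y → Admissible y [] → Balanced y
Admissible[]⇒Balanced [] _ = []
Admissible[]⇒Balanced (y ∷ ys) (p ∷ ps , _ ∷ gs) =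
  All.zipWith (λ pq → pq) (All-withAbove proj₁ ys [] p , RowRel⇒window ys [] (λ ()) p)
  ∷ Admissible[]⇒Balanced ys (ps , gs)

-- Where r fits below u, an admissible row y below u is tight against r: if
-- yᵢ < rᵢ ≤ uᵢ - 2 then uᵢ ≠ yᵢ + 2, so the rest of y is at most yᵢ + 1.
Admissible⇒Tight : ∀ g y u r → Admissible y u → Fits (take g r) (take g u) → Tight g y r
Admissible⇒Tight zero y u r _ _ = tt
Admissible⇒Tight (suc g) [] u r _ _ = tt
Admissible⇒Tight (suc g) (y ∷ ys) u [] _ _ = tt
Admissible⇒Tight (suc g) (y ∷ ys) [] (r ∷ rs) (p ∷ ps , _ ∷ gs) _ =
  (λ _ → RowRel⇒window ys [] (λ ()) p) ,
  Admissible⇒Tight g ys [] rs (ps , gs) (subst (Fits (take g rs)) (sym (LP.take-[] g)) (fits-[] (take g rs)))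
  where
  fits-[] : ∀ xs → Fits xs []
  fits-[] [] = tt
  fits-[] (_ ∷ _) = tt
Admissible⇒Tight (suc g) (y ∷ ys) (w ∷ us) (r ∷ rs) (p ∷ ps , _ ∷ gs) (r≤w-2 , fit) =
  (λ y<r → RowRel⇒window ys us (λ { refl w≡ → ℤP.<-irrefl refl (ℤP.<-≤-trans y<r
      (ℤP.≤-trans r≤w-2 (ℤP.≤-reflexive (trans (cong under w≡) (+2-under y))))) }) p) ,
  Admissible⇒Tight g ys us rs (ps , gs) fit

Admissible⇒no-Clash : ∀ g y u → Admissible y u → Clash (take g y) (take g u) → ⊥
Admissible⇒no-Clash (suc g) (y ∷ ys) (w ∷ us) (_ , y+2≤w ∷ _) (inj₁ w-2<y) =
  ℤP.<-irrefl refl (ℤP.<-≤-trans w-2<y (+2≤⇒≤under y+2≤w))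
Admissible⇒no-Clash (suc g) (y ∷ ys) (w ∷ us) (_ ∷ ps , _ ∷ gs) (inj₂ cl) =
  Admissible⇒no-Clash g ys us (ps , gs) cl

-- Dichotomy for an admissible row y below u whose first group of u is
-- balanced: either y starts with that group lowered by two, or y lies in a
-- window [m, m + 1] (the first entry not two below u bounds all of y;
-- the witnesses that m occurs in y and m + 2 < some entry of u drive the induction).
admissible-dichotomy : ∀ g y u → g ℕ.≤ length y → g ℕ.≤ length u → Admissible y u → Balanced (take g u) →
  (take g y ≡ map under (take g u)) ⊎ Σ ℤ (λ m → All (m ≤_) y × All (_≤ m + 1ℤ) y × Any (m ≡_) y × Any (λ w → m + two < w) (take g u))
admissible-dichotomy zero y u _ _ _ _ = inj₁ refl
admissible-dichotomy (suc g) (y ∷ ys) (w ∷ us) (ℕ.s≤s gy) (ℕ.s≤s gu) (p ∷ ps , y+2≤w ∷ gs) (w≈ ∷ bal)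
  with w ℤP.≟ y + two
... | no w≢ = inj₂ (y , ℤP.≤-refl ∷ All-withAbove proj₁ ys us p ,
                        ℤP.i≤i+j y 1ℤ ∷ RowRel⇒window ys us (λ { refl w≡ → w≢ w≡ }) p ,
                        here refl , here (ℤP.≤∧≢⇒< y+2≤w (w≢ ∘ sym)))
... | yes w≡ with admissible-dichotomy g ys us gy gu (ps , gs) bal
...   | inj₁ e = inj₁ (cong₂ _∷_ (sym (trans (cong under w≡) (+2-under y))) e)
...   | inj₂ (m , m≤ , ≤m+1 , m∈ys , m+2<) =
  inj₂ (m , m≤y ∷ m≤ , ℤP.≤-trans y≤m (ℤP.i≤i+j m 1ℤ) ∷ ≤m+1 , there m∈ys , there m+2<)
  where
  y≤m : y ≤ m
  y≤m = let y≤x , m≡x = All.lookupAny (All-withAbove proj₁ ys us p) m∈ys in subst (y ≤_) (sym m≡x) y≤x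
  m≤y : m ≤ y
  m≤y = let (_ , x≤w+1) , m+2<x = All.lookupAny w≈ m+2< in
    cancel (<+1⇒≤ (ℤP.<-≤-trans m+2<x (ℤP.≤-trans x≤w+1 (ℤP.≤-reflexive (cong (_+ 1ℤ) w≡)))))
    where
    cancel : m + two ≤ y + two → m ≤ y
    cancel le = subst₂ _≤_ (+2-under m) (+2-under y) (ℤP.+-monoˡ-≤ (- two) le)

rowStep-complete : ∀ gs d a b u y → b ≡ sumℕ gs ℕ.+ d → length u ≡ sumℕ gs → BlocksBalanced gs u →
  Admissible y u → length y ≡ b → sumℤ y ≡ a → rowStep a b (gs ++ d ∷ []) u ≡ y
rowStep-complete [] d a b [] y refl _ _ adm ly sy rewrite rowStep-last a b d =
  trans (LP.take-all d (Bcomp a b) (ℕP.≤-reflexive (Bcomp-length a b)))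
        (Balanced-unique (Bcomp a b) y (trans (Bcomp-length a b) (sym ly))
           (trans (Bcomp-sum-of a b y ly sy) (sym sy)) (Bcomp-balanced a b) (Admissible[]⇒Balanced y adm))
rowStep-complete (g ∷ gs) d a b u y eb eu (bal , bals) adm ly sy = by-step (stepView a b g (gs ++ d ∷ []) u)
  where
  r = Bcomp a b
  g≤y : g ℕ.≤ length y
  g≤y = subst (g ℕ.≤_) (sym ly) (group≤ g (sumℕ gs) d b eb)
  g≤u = group≤length g (sumℕ gs) u eu
  same-length : length y ≡ length r
  same-length = trans ly (sym (Bcomp-length a b))
  same-sum : sumℤ y ≡ sumℤ r
  same-sum = trans sy (sym (Bcomp-sum-of a b y ly sy))

  continue : ∀ tg → take g y ≡ tg → tg ++ rowStep (a - sumℤ tg) (b ℕ.∸ g) (gs ++ d ∷ []) (drop g u) ≡ y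
  continue tg refl =
    trans (cong (take g y ++_)
            (rowStep-complete gs d _ _ (drop g u) (drop g y) (∸-group g (sumℕ gs) d b eb)
               (length-drop-group g (sumℕ gs) u eu) bals (Admissible-drop g y u adm)
               (trans (LP.length-drop g y) (cong (ℕ._∸ g) ly)) (sumℤ-drop g y sy refl)))
          (LP.take++drop≡id g y)

  -- In the clashing case y cannot be balanced (it would then equal Bcomp,
  -- which clashes), so it starts with the row above lowered by two.
  replaced-prefix : okAbove (take g r) (take g u) ≡ false → take g y ≡ map under (take g u)
  replaced-prefix ok with admissible-dichotomy g y u g≤y g≤u adm bal
  ... | inj₁ e = e
  ... | inj₂ (m , lo , hi , _ , _) =
    ⊥-elim (Admissible⇒no-Clash g y u adm (subst (λ z → Clash (take g z) (take g u)) (sym y≡r) (okAbove-false⇒Clash _ _ ok)))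
    where
    y≡r : y ≡ r
    y≡r = Balanced-unique y r same-length same-sum
            (squeezed⇒Balanced (Admissible⇒Sorted y u adm) lo hi) (Bcomp-balanced a b)

  by-step : StepView a b g (gs ++ d ∷ []) u → rowStep a b (g ∷ gs ++ d ∷ []) u ≡ y
  by-step (fits ok eq) = trans eq (continue (take g r)
    (prefix-rigid g y r same-length same-sum (Bcomp-balanced a b) (Admissible⇒Sorted y u adm)
       (Admissible⇒Tight g y u r adm (okAbove-true⇒Fits _ _ ok))))
  by-step (clashes ok eq) = trans eq (continue (map under (take g u)) (replaced-prefix ok))

AdmissibleRows : List (List ℤ) → Set
AdmissibleRows [] = ⊤
AdmissibleRows (x ∷ F) = Admissible x (headRow F) × AdmissibleRows F

groups : List ℕ → List ℕ
groups μ = reverse (diffs μ)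

groups-∷ : ∀ m m′ ms → groups (m ∷ m′ ∷ ms) ≡ groups (m′ ∷ ms) ++ (m ℕ.∸ m′) ∷ []
groups-∷ m m′ ms = LP.unfold-reverse (m ℕ.∸ m′) (diffs (m′ ∷ ms))

sumℕ-++ : ∀ xs ys → sumℕ (xs ++ ys) ≡ sumℕ xs ℕ.+ sumℕ ys
sumℕ-++ [] ys = refl
sumℕ-++ (x ∷ xs) ys = trans (cong (x ℕ.+_) (sumℕ-++ xs ys)) (sym (ℕP.+-assoc x _ _))

sum-groups : ∀ m ms → Linked ℕ._≥_ (m ∷ ms) → sumℕ (groups (m ∷ ms)) ≡ m
sum-groups m [] _ = ℕP.+-identityʳ m
sum-groups m (m′ ∷ ms) (m′≤m ∷ l) = begin
    sumℕ (groups (m ∷ m′ ∷ ms))                          ≡⟨ cong sumℕ (groups-∷ m m′ ms) ⟩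
    sumℕ (groups (m′ ∷ ms) ++ (m ℕ.∸ m′) ∷ [])           ≡⟨ sumℕ-++ (groups (m′ ∷ ms)) _ ⟩
    sumℕ (groups (m′ ∷ ms)) ℕ.+ ((m ℕ.∸ m′) ℕ.+ 0)        ≡⟨ cong₂ ℕ._+_ (sum-groups m′ ms l) (ℕP.+-identityʳ _) ⟩
    m′ ℕ.+ (m ℕ.∸ m′)                                    ≡⟨ ℕP.m+[n∸m]≡n m′≤m ⟩
    m ∎
  where open ≡-Reasoning

row-length : ∀ m m′ ms → m′ ℕ.≤ m → Linked ℕ._≥_ (m′ ∷ ms) → m ≡ sumℕ (groups (m′ ∷ ms)) ℕ.+ (m ℕ.∸ m′)
row-length m m′ ms m′≤m l = trans (sym (ℕP.m+[n∸m]≡n m′≤m)) (cong (ℕ._+ (m ℕ.∸ m′)) (sym (sum-groups m′ ms l)))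

firstPart : List ℕ → ℕ
firstPart [] = 0
firstPart (m ∷ _) = m

AdmissibleRows⇒Sorted : ∀ F → AdmissibleRows F → Sorted (headRow F)
AdmissibleRows⇒Sorted [] _ = []
AdmissibleRows⇒Sorted (x ∷ F) (adm , _) = Admissible⇒Sorted x (headRow F) adm

Fram-sound : ∀ μ s → Linked ℕ._≥_ μ → length s ≡ length μ →
  AdmissibleRows (Fram μ s) × BlocksBalanced (groups μ) (headRow (Fram μ s)) × length (headRow (Fram μ s)) ≡ firstPart μ
Fram-sound [] s _ _ = tt , tt , refl
Fram-sound (m ∷ []) (x ∷ ss) _ _ =
  let adm , len , blocks = rowStep-sound [] m (+ x) m [] refl refl [] tt in (adm , tt) , blocks , len
Fram-sound (m ∷ m′ ∷ ms) (x ∷ ss) (m′≤m ∷ l) e rewrite groups-∷ m m′ ms =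
  (adm , adms) , blocks , len
  where
  above = Fram-sound (m′ ∷ ms) ss l (ℕP.suc-injective e)
  adms = proj₁ above
  u = headRow (Fram (m′ ∷ ms) ss)
  bottom = rowStep-sound (groups (m′ ∷ ms)) (m ℕ.∸ m′) (+ x) m u (row-length m m′ ms m′≤m l)
             (trans (proj₂ (proj₂ above)) (sym (sum-groups m′ ms l)))
             (AdmissibleRows⇒Sorted (Fram (m′ ∷ ms) ss) adms) (proj₁ (proj₂ above))
  adm = proj₁ bottom
  len = proj₁ (proj₂ bottom)
  blocks = proj₂ (proj₂ bottom)

toℤ : ℕ → ℤ
toℤ n = + n

sumℤ-map-+ : ∀ x → sumℤ (map toℤ x) ≡ + sumℕ x
sumℤ-map-+ [] = refl
sumℤ-map-+ (x ∷ xs) = trans (cong (λ t → + x + t) (sumℤ-map-+ xs)) (sym (ℤP.pos-+ x (sumℕ xs)))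

length-map-sumℕ : ∀ (T : List (List ℕ)) → length (map sumℕ T) ≡ length (map length T)
length-map-sumℕ T = trans (LP.length-map sumℕ T) (sym (LP.length-map length T))

Fram-complete : ∀ T → Linked ℕ._≥_ (map length T) → AdmissibleRows (map (map toℤ) T) →
  Fram (map length T) (map sumℕ T) ≡ map (map toℤ) T
Fram-complete [] _ _ = refl
Fram-complete (x ∷ []) _ (adm , _) =
  cong (_∷ []) (rowStep-complete [] (length x) (+ sumℕ x) (length x) [] (map toℤ x) refl refl tt adm
                  (LP.length-map toℤ x) (sumℤ-map-+ x))
Fram-complete (x ∷ y ∷ T) (m′≤m ∷ l) (adm , adms) = cong₂ _∷_ bottom above
  where
  m = length x
  m′ = length y
  ms = map length T
  above : Fram (m′ ∷ ms) (map sumℕ (y ∷ T)) ≡ map (map toℤ) (y ∷ T)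
  above = Fram-complete (y ∷ T) l adms
  u = headRow (Fram (m′ ∷ ms) (map sumℕ (y ∷ T)))
  shape = Fram-sound (m′ ∷ ms) (map sumℕ (y ∷ T)) l (length-map-sumℕ (y ∷ T))
  bottom : rowStep (+ sumℕ x) m (groups (m ∷ m′ ∷ ms)) u ≡ map toℤ x
  bottom rewrite groups-∷ m m′ ms =
    rowStep-complete (groups (m′ ∷ ms)) (m ℕ.∸ m′) (+ sumℕ x) m u (map toℤ x) (row-length m m′ ms m′≤m l)
      (trans (proj₂ (proj₂ shape)) (sym (sum-groups m′ ms l))) (proj₁ (proj₂ shape))
      (subst (Admissible (map toℤ x)) (sym (cong headRow above)) adm) (LP.length-map toℤ x) (sumℤ-map-+ x)

at-map : ∀ {A B : Set} (f : A → B) xs j → at (map f xs) j ≡ Maybe.map f (at xs j)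
at-map f [] j = refl
at-map f (x ∷ xs) zero = refl
at-map f (x ∷ xs) (suc zero) = refl
at-map f (x ∷ xs) (suc (suc j)) = at-map f xs (suc j)

at-map⁻ : ∀ {A B : Set} (f : A → B) xs j {b} → at (map f xs) j ≡ just b → Σ A λ a → at xs j ≡ just a × f a ≡ b
at-map⁻ f xs j e rewrite at-map f xs j with at xs j
... | just a = a , refl , just-injective e

at-withAbove : ∀ x u j → at (withAbove x u) j ≡ Maybe.map (λ a → a , at u j) (at x j)
at-withAbove [] u j = refl
at-withAbove (x ∷ xs) [] zero = refl
at-withAbove (x ∷ xs) (w ∷ u) zero = refl
at-withAbove (x ∷ xs) [] (suc zero) = refl
at-withAbove (x ∷ xs) (w ∷ u) (suc zero) = refl
at-withAbove (x ∷ xs) [] (suc (suc j)) = at-withAbove xs [] (suc j)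
at-withAbove (x ∷ xs) (w ∷ u) (suc (suc j)) = at-withAbove xs u (suc j)

Cellℕ : List ℕ → ℕ → ℕ → Cell
Cellℕ u j a = toℤ a , Maybe.map toℤ (at u j)

cell-at : ∀ x u j {c} → at (withAbove (map toℤ x) (map toℤ u)) j ≡ just c →
  Σ ℕ λ a → at x j ≡ just a × c ≡ Cellℕ u j a
cell-at x u j e rewrite at-withAbove (map toℤ x) (map toℤ u) j | at-map toℤ u j with at-map⁻ toℤ x j (lemma e)
  where
  lemma : ∀ {m : Maybe ℤ} {c} → Maybe.map (λ a → a , Maybe.map toℤ (at u j)) m ≡ just c → m ≡ just (proj₁ c)
  lemma {just a} refl = refl
... | a , xa , refl with at (map toℤ x) j | e
... | just _ | refl = a , xa , refl

at-cell : ∀ x u j {a} → at x j ≡ just a → at (withAbove (map toℤ x) (map toℤ u)) j ≡ just (Cellℕ u j a)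
at-cell x u j e rewrite at-withAbove (map toℤ x) (map toℤ u) j | at-map toℤ x j | at-map toℤ u j | e = refl

at-zero : ∀ {A : Set} (xs : List A) {a} → at xs 0 ≡ just a → ⊥
at-zero [] ()
at-zero (x ∷ xs) ()

All-at : ∀ {A : Set} {P : A → Set} {xs} j {a} → All P xs → at xs j ≡ just a → P a
All-at (suc zero) (px ∷ _) refl = px
All-at (suc (suc j)) (_ ∷ pxs) e = All-at (suc j) pxs e

at-All : ∀ {A : Set} {P : A → Set} xs → (∀ j {a} → at xs j ≡ just a → P a) → All P xs
at-All [] _ = []
at-All (x ∷ xs) f = f 1 refl ∷ at-All xs (λ j → f (suc j) ∘ shift j)
  where
  shift : ∀ j {a} → at xs j ≡ just a → at (x ∷ xs) (suc j) ≡ just a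
  shift zero e = ⊥-elim (at-zero xs e)
  shift (suc j) e = e

AllPairs-at : ∀ {A : Set} {R : A → A → Set} {xs} j j′ {a b} → AllPairs R xs → j ℕ.< j′ →
  at xs j ≡ just a → at xs j′ ≡ just b → R a b
AllPairs-at {xs = xs} zero _ _ _ e _ = ⊥-elim (at-zero xs e)
AllPairs-at (suc zero) (suc zero) _ (ℕ.s≤s ()) _ _
AllPairs-at (suc zero) (suc (suc j′)) (px ∷ _) _ refl e′ = All-at (suc j′) px e′
AllPairs-at (suc (suc j)) (suc (suc j′)) (_ ∷ pxs) (ℕ.s≤s j<j′) e e′ = AllPairs-at (suc j) (suc j′) pxs j<j′ e e′

at-AllPairs : ∀ {A : Set} {R : A → A → Set} xs → (∀ j j′ {a b} → j ℕ.< j′ → at xs j ≡ just a → at xs j′ ≡ just b → R a b) →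
  AllPairs R xs
at-AllPairs [] _ = []
at-AllPairs (x ∷ xs) f =
  at-All xs (λ { zero e → ⊥-elim (at-zero xs e) ; (suc j) e → f 1 (suc (suc j)) (ℕ.s≤s (ℕ.s≤s ℕ.z≤n)) refl e })
  ∷ at-AllPairs xs (λ { zero _ _ e _ → ⊥-elim (at-zero xs e) ; (suc j) (suc j′) (ℕ.s≤s j<j′) e e′ → f (suc (suc j)) (suc (suc j′)) (ℕ.s≤s (ℕ.s≤s j<j′)) e e′ })

WeaklyIncreasing : List ℕ → Set
WeaklyIncreasing x = ∀ j a → at x j ≡ just a → a ≤∞ at x (suc j)

ColumnGaps : List ℕ → List ℕ → Set
ColumnGaps x u = ∀ j a b → at x j ≡ just a → at u j ≡ just b → a ℕ.+ 2 ℕ.≤ b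

RowConditionBelow : List ℕ → List ℕ → Set
RowConditionBelow x u = ∀ j j′ a b → j ℕ.< j′ → at x j ≡ just a → at x j′ ≡ just b → a ℕ.≤ b →
  (b ℕ.∸ a ℕ.≤ 1) ⊎ (at u j ≡ just (a ℕ.+ 2))

RowConditions : List ℕ → List ℕ → Set
RowConditions x u = WeaklyIncreasing x × ColumnGaps x u × RowConditionBelow x u

toℤ-+2 : ∀ a → toℤ a + two ≡ toℤ (a ℕ.+ 2)
toℤ-+2 a = sym (ℤP.pos-+ a 2)

toℤ-+1 : ∀ a → toℤ a + 1ℤ ≡ toℤ (a ℕ.+ 1)
toℤ-+1 a = sym (ℤP.pos-+ a 1)

tight⇒ℕ : ∀ (d : Maybe ℕ) a → Maybe.map toℤ d ≡ just (toℤ a + two) → d ≡ just (a ℕ.+ 2)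
tight⇒ℕ (just e) a eq = cong just (ℤP.+-injective (trans (just-injective eq) (toℤ-+2 a)))

tight⇒ℤ : ∀ (d : Maybe ℕ) a → d ≡ just (a ℕ.+ 2) → Maybe.map toℤ d ≡ just (toℤ a + two)
tight⇒ℤ _ a refl = cong just (sym (toℤ-+2 a))

Sorted⇒WeaklyIncreasing : ∀ x → Sorted (map toℤ x) → WeaklyIncreasing x
Sorted⇒WeaklyIncreasing x s j a e with at x (suc j) in e′
... | nothing = tt
... | just b = ℤP.drop‿+≤+ (AllPairs-at j (suc j) s (ℕP.n<1+n j)
                 (trans (at-map toℤ x j) (cong (Maybe.map toℤ) e))
                 (trans (at-map toℤ x (suc j)) (cong (Maybe.map toℤ) e′)))

WeaklyIncreasing⇒Sorted : ∀ x → WeaklyIncreasing x → Sorted (map toℤ x)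
WeaklyIncreasing⇒Sorted [] _ = []
WeaklyIncreasing⇒Sorted (a ∷ xs) inc = head≤ xs (inc 1 a refl) sorted ∷ sorted
  where
  sorted = WeaklyIncreasing⇒Sorted xs λ { zero c e → ⊥-elim (at-zero xs e) ; (suc j) → inc (suc (suc j)) }
  head≤ : ∀ xs → a ≤∞ at xs 1 → Sorted (map toℤ xs) → All (toℤ a ≤_) (map toℤ xs)
  head≤ [] _ _ = []
  head≤ (b ∷ xs) a≤b (b≤ ∷ _) = ℤ.+≤+ a≤b ∷ All.map (ℤP.≤-trans (ℤ.+≤+ a≤b)) b≤

Admissible⇒RowConditions : ∀ x u → Admissible (map toℤ x) (map toℤ u) → RowConditions x u
Admissible⇒RowConditions x u adm@(pairs , gaps) =
  Sorted⇒WeaklyIncreasing x (Admissible⇒Sorted (map toℤ x) (map toℤ u) adm) , column , row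
  where
  column : ColumnGaps x u
  column j a b xa ub = ℤP.drop‿+≤+ (subst₂ _≤_ (toℤ-+2 a) refl gap)
    where
    gap : GapAbove (toℤ a , just (toℤ b))
    gap = subst (λ d → GapAbove (toℤ a , Maybe.map toℤ d)) ub (All-at j gaps (at-cell x u j xa))
  row : RowConditionBelow x u
  row j j′ a b j<j′ xa xb _ with proj₂ (AllPairs-at j j′ pairs j<j′ (at-cell x u j xa) (at-cell x u j′ xb))
  ... | inj₁ b≤a+1 = inj₁ (ℕP.m≤n+o⇒m∸n≤o b a (ℤP.drop‿+≤+ (subst (toℤ b ≤_) (toℤ-+1 a) b≤a+1)))
  ... | inj₂ tight = inj₂ (tight⇒ℕ (at u j) a tight)

RowConditions⇒Admissible : ∀ x u → RowConditions x u → Admissible (map toℤ x) (map toℤ u)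
RowConditions⇒Admissible x u (inc , column , row) =
  at-AllPairs _ pair , at-All _ gap
  where
  sorted = WeaklyIncreasing⇒Sorted x inc
  pair : ∀ j j′ {c c′} → j ℕ.< j′ → at (withAbove (map toℤ x) (map toℤ u)) j ≡ just c →
    at (withAbove (map toℤ x) (map toℤ u)) j′ ≡ just c′ → RowRel c c′
  pair j j′ j<j′ e e′ with cell-at x u j e | cell-at x u j′ e′
  ... | a , xa , refl | b , xb , refl = +a≤+b , window (row j j′ a b j<j′ xa xb a≤b)
    where
    +a≤+b : toℤ a ≤ toℤ b
    +a≤+b = AllPairs-at j j′ sorted j<j′ (trans (at-map toℤ x j) (cong (Maybe.map toℤ) xa))
                                         (trans (at-map toℤ x j′) (cong (Maybe.map toℤ) xb))
    a≤b = ℤP.drop‿+≤+ +a≤+b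
    window : (b ℕ.∸ a ℕ.≤ 1) ⊎ (at u j ≡ just (a ℕ.+ 2)) →
      (toℤ b ≤ toℤ a + 1ℤ) ⊎ (Maybe.map toℤ (at u j) ≡ just (toℤ a + two))
    window (inj₁ b-a≤1) = inj₁ (subst (toℤ b ≤_) (sym (toℤ-+1 a))
      (ℤ.+≤+ (subst (ℕ._≤ a ℕ.+ 1) (ℕP.m+[n∸m]≡n a≤b) (ℕP.+-monoʳ-≤ a b-a≤1))))
    window (inj₂ tight) = inj₂ (tight⇒ℤ (at u j) a tight)
  gap : ∀ j {c} → at (withAbove (map toℤ x) (map toℤ u)) j ≡ just c → GapAbove c
  gap j e with cell-at x u j e
  ... | a , xa , refl with at u j in ub
  ...   | nothing = tt
  ...   | just b = subst (_≤ toℤ b) (sym (toℤ-+2 a)) (ℤ.+≤+ (column j a b xa ub))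

nextRow : List (List ℕ) → List ℕ
nextRow [] = []
nextRow (y ∷ _) = y

RowsConditions : List (List ℕ) → Set
RowsConditions [] = ⊤
RowsConditions (x ∷ T) = RowConditions x (nextRow T) × RowsConditions T

headRow-map : ∀ T → headRow (map (map toℤ) T) ≡ map toℤ (nextRow T)
headRow-map [] = refl
headRow-map (y ∷ T) = refl

AdmissibleRows⇒RowsConditions : ∀ T → AdmissibleRows (map (map toℤ) T) → RowsConditions T
AdmissibleRows⇒RowsConditions [] _ = tt
AdmissibleRows⇒RowsConditions (x ∷ T) (adm , adms) =
  Admissible⇒RowConditions x (nextRow T) (subst (Admissible (map toℤ x)) (headRow-map T) adm) ,
  AdmissibleRows⇒RowsConditions T adms

RowsConditions⇒AdmissibleRows : ∀ T → RowsConditions T → AdmissibleRows (map (map toℤ) T)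
RowsConditions⇒AdmissibleRows [] _ = tt
RowsConditions⇒AdmissibleRows (x ∷ T) (conds , condss) =
  subst (Admissible (map toℤ x)) (sym (headRow-map T)) (RowConditions⇒Admissible x (nextRow T) conds) ,
  RowsConditions⇒AdmissibleRows T condss

entry-next : ∀ T j → entry T 1 j ≡ at (nextRow T) j
entry-next [] j = refl
entry-next (y ∷ T) j = refl

entry-zero : ∀ T j {a} → entry T 0 j ≡ just a → ⊥
entry-zero [] j ()
entry-zero (x ∷ T) j ()

gap⇒+2≤ : ∀ a b → a ℕ.≤ b → 2 ℕ.≤ ℕ.∣ a - b ∣ → a ℕ.+ 2 ℕ.≤ b
gap⇒+2≤ a b a≤b p =
  subst (a ℕ.+ 2 ℕ.≤_) (ℕP.m+[n∸m]≡n a≤b) (ℕP.+-monoʳ-≤ a (subst (2 ℕ.≤_) (ℕP.m≤n⇒∣m-n∣≡n∸m a≤b) p))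

+2≤⇒gap : ∀ a b → a ℕ.+ 2 ℕ.≤ b → 2 ℕ.≤ ℕ.∣ a - b ∣
+2≤⇒gap a b p =
  subst (2 ℕ.≤_) (sym (ℕP.m≤n⇒∣m-n∣≡n∸m a≤b)) (subst (ℕ._≤ b ℕ.∸ a) (ℕP.m+n∸m≡n a 2) (ℕP.∸-monoˡ-≤ a p))
  where a≤b = ℕP.≤-trans (ℕP.m≤m+n a 2) p

conditions-above : ∀ x T → ColumnStrict (x ∷ T) × ColumnGap (x ∷ T) × RowCondition (x ∷ T) →
  ColumnStrict T × ColumnGap T × RowCondition T
conditions-above x T (strict , gap , row) = strict′ , gap′ , row′
  where
  strict′ : ColumnStrict T
  strict′ zero j a e = ⊥-elim (entry-zero T j e)
  strict′ (suc i) = strict (suc (suc i))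
  gap′ : ColumnGap T
  gap′ zero _ j _ _ _ e _ = ⊥-elim (entry-zero T j e)
  gap′ (suc i) zero j _ _ _ _ e = ⊥-elim (entry-zero T j e)
  gap′ (suc i) (suc i′) j a b i≢i′ = gap (suc (suc i)) (suc (suc i′)) j a b (i≢i′ ∘ ℕP.suc-injective)
  row′ : RowCondition T
  row′ zero j _ _ _ _ e = ⊥-elim (entry-zero T j e)
  row′ (suc i) = row (suc (suc i))

conditions-bottom : ∀ x T → ColumnStrict (x ∷ T) × ColumnGap (x ∷ T) × RowCondition (x ∷ T) →
  RowConditions x (nextRow T)
conditions-bottom x T (strict , gap , row) = inc , column , rowcond
  where
  inc : WeaklyIncreasing x
  inc j a e = proj₂ (strict 1 j a e)
  column : ColumnGaps x (nextRow T)
  column j a b e e′ = gap⇒+2≤ a b (ℕP.<⇒≤ a<b) (gap 1 2 j a b (λ ()) e e″)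
    where
    e″ : entry (x ∷ T) 2 j ≡ just b
    e″ = trans (entry-next T j) e′
    a<b : a ℕ.< b
    a<b = subst (a <∞_) e″ (proj₁ (strict 1 j a e))
  rowcond : RowConditionBelow x (nextRow T)
  rowcond j j′ a b j<j′ e e′ a≤b with row 1 j j′ a b j<j′ e e′ a≤b
  ... | inj₁ q = inj₁ q
  ... | inj₂ q = inj₂ (trans (sym (entry-next T j)) q)

tableau⇒RowsConditions : ∀ T → ColumnStrict T → ColumnGap T → RowCondition T → RowsConditions T
tableau⇒RowsConditions [] _ _ _ = tt
tableau⇒RowsConditions (x ∷ T) strict gap row =
  conditions-bottom x T (strict , gap , row) ,
  (let strict′ , gap′ , row′ = conditions-above x T (strict , gap , row)
   in tableau⇒RowsConditions T strict′ gap′ row′)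

RowsConditions⇒ColumnStrict : ∀ T → RowsConditions T → ColumnStrict T
RowsConditions⇒ColumnStrict (x ∷ T) ((inc , column , _) , _) (suc zero) j a e = below-next , inc j a e
  where
  below-next : a <∞ entry T 1 j
  below-next rewrite entry-next T j with at (nextRow T) j in e′
  ... | nothing = tt
  ... | just b = ℕP.<-≤-trans (ℕP.m<m+n a (ℕ.s≤s ℕ.z≤n)) (column j a b e e′)
RowsConditions⇒ColumnStrict (x ∷ T) (_ , conds) (suc (suc i)) = RowsConditions⇒ColumnStrict T conds (suc i)

RowsConditions⇒RowCondition : ∀ T → RowsConditions T → RowCondition T
RowsConditions⇒RowCondition (x ∷ T) ((_ , _ , row) , _) (suc zero) j j′ a b j<j′ e e′ a≤b
  with row j j′ a b j<j′ e e′ a≤b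
... | inj₁ q = inj₁ q
... | inj₂ q = inj₂ (trans (entry-next T j) q)
RowsConditions⇒RowCondition (x ∷ T) (_ , conds) (suc (suc i)) = RowsConditions⇒RowCondition T conds (suc i)

at-longer : ∀ (xs ys : List ℕ) j {c} → at ys j ≡ just c → length ys ℕ.≤ length xs → Σ ℕ λ d → at xs j ≡ just d
at-longer (x ∷ xs) (y ∷ ys) (suc zero) _ _ = x , refl
at-longer (x ∷ xs) (y ∷ ys) (suc (suc j)) e (ℕ.s≤s le) = at-longer xs ys (suc j) e le

cell-below : ∀ T → Linked ℕ._≥_ (map length T) → ∀ i j {b} → entry T (suc i) j ≡ just b → Σ ℕ λ c → entry T 1 j ≡ just c
cell-below T _ zero j {b} e = b , e
cell-below (x ∷ y ∷ T) (y≤x ∷ l) (suc i) j e =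
  let c , e′ = cell-below (y ∷ T) l i j e in at-longer x y j e′ y≤x

Linked-tail : ∀ {y ys} → Linked ℕ._≥_ (y ∷ ys) → Linked ℕ._≥_ ys
Linked-tail [-] = []
Linked-tail (_ ∷ l) = l

-- Entries increase by at least two from each row to any higher row in the
-- same column: chain the column gaps through the intermediate cells.
column-increase : ∀ T → Linked ℕ._≥_ (map length T) → RowsConditions T → ∀ i k j {a b} →
  entry T (suc i) j ≡ just a → entry T (suc (suc i ℕ.+ k)) j ≡ just b → a ℕ.+ 2 ℕ.≤ b
column-increase (x ∷ T) _ ((_ , column , _) , _) zero zero j e e′ = column j _ _ e (trans (sym (entry-next T j)) e′)
column-increase (x ∷ T) l ((_ , column , _) , conds) zero (suc k) j {a} {b} e e′ =
  let c , ec = cell-below T (Linked-tail l) (suc k) j e′ in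
  ℕP.≤-trans (column j a c e (trans (sym (entry-next T j)) ec))
    (ℕP.≤-trans (ℕP.m≤m+n c 2) (column-increase T (Linked-tail l) conds zero k j ec e′))
column-increase (x ∷ T) l (_ , conds) (suc i) k j e e′ = column-increase T (Linked-tail l) conds i k j e e′

RowsConditions⇒ColumnGap : ∀ T → Linked ℕ._≥_ (map length T) → RowsConditions T → ColumnGap T
RowsConditions⇒ColumnGap T l conds zero _ j _ _ _ e _ = ⊥-elim (entry-zero T j e)
RowsConditions⇒ColumnGap T l conds (suc p) zero j _ _ _ _ e = ⊥-elim (entry-zero T j e)
RowsConditions⇒ColumnGap T l conds (suc p) (suc q) j a b p≢q e e′ with ℕP.<-cmp p q
... | tri< p<q _ _ = +2≤⇒gap a b (column-increase T l conds p (q ℕ.∸ suc p) j e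
        (subst (λ z → entry T (suc z) j ≡ just b) (sym (ℕP.m+[n∸m]≡n p<q)) e′))
... | tri≈ _ p≡q _ = ⊥-elim (p≢q (cong suc p≡q))
... | tri> _ _ q<p = subst (2 ℕ.≤_) (ℕP.∣-∣-comm b a) (+2≤⇒gap b a (column-increase T l conds q (p ℕ.∸ suc q) j e′
        (subst (λ z → entry T (suc z) j ≡ just a) (sym (ℕP.m+[n∸m]≡n q<p)) e)))

ColumnGaps-lift : ∀ x u c → ColumnGaps x u → length u ℕ.≤ length x → All (c ℕ.≤_) x → All (c ℕ.+ 2 ℕ.≤_) u
ColumnGaps-lift x [] c _ _ _ = []
ColumnGaps-lift (a ∷ xs) (b ∷ us) c column (ℕ.s≤s le) (c≤a ∷ p) =
  ℕP.≤-trans (ℕP.+-monoˡ-≤ 2 c≤a) (column 1 a b refl refl) ∷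
  ColumnGaps-lift xs us c (λ { zero _ _ e _ → ⊥-elim (at-zero xs e) ; (suc j) → column (suc (suc j)) }) le p

rows-lower-bound : ∀ T c → Linked ℕ._≥_ (map length T) → RowsConditions T → All (c ℕ.≤_) (nextRow T) →
  ∀ i X → at T (suc i) ≡ just X → All (c ℕ.+ 2 ℕ.* i ℕ.≤_) X
rows-lower-bound (x ∷ T) c _ _ p zero X refl = subst (λ z → All (z ℕ.≤_) x) (sym (ℕP.+-identityʳ c)) p
rows-lower-bound (x ∷ T) c l ((_ , column , _) , conds) p (suc i) X e =
  subst (λ z → All (z ℕ.≤_) X) (ring c i)
    (rows-lower-bound T (c ℕ.+ 2) (Linked-tail l) conds (ColumnGaps-lift x (nextRow T) c column (shorter T l) p) i X e)
  where
  ring : ∀ c i → c ℕ.+ 2 ℕ.+ 2 ℕ.* i ≡ c ℕ.+ 2 ℕ.* (1 ℕ.+ i)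
  ring = ℕSolver.solve-∀
  shorter : ∀ T → Linked ℕ._≥_ (map length (x ∷ T)) → length (nextRow T) ℕ.≤ length x
  shorter [] _ = ℕ.z≤n
  shorter (y ∷ T) (y≤x ∷ _) = y≤x

sum-lower-bound : ∀ c x → All (c ℕ.≤_) x → c ℕ.* length x ℕ.≤ sumℕ x
sum-lower-bound c [] _ = ℕP.≤-reflexive (ℕP.*-zeroʳ c)
sum-lower-bound c (x ∷ xs) (c≤x ∷ p) =
  ℕP.≤-trans (ℕP.≤-reflexive (ℕP.*-suc c (length xs))) (ℕP.+-mono-≤ c≤x (sum-lower-bound c xs p))

-- First framing inequality: entries of row i are at least 2i - 1.
framing-rows : ∀ T → Linked ℕ._≥_ (map length T) → RowsConditions T → All (All (0 ℕ.<_)) T →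
  ∀ i m s → at (map length T) i ≡ just m → at (map sumℕ T) i ≡ just s → (2 ℕ.* i ℕ.∸ 1) ℕ.* m ℕ.≤ s
framing-rows (x ∷ T) l conds (pos ∷ _) (suc i) m s em es
  with at-map⁻ length (x ∷ T) (suc i) em | at-map⁻ sumℕ (x ∷ T) (suc i) es
... | X , eX , refl | X′ , eX′ , refl with trans (sym eX) eX′
... | refl = subst (λ k → k ℕ.* length X ℕ.≤ sumℕ X) (cong (ℕ._∸ 1) (sym (ℕP.*-suc 2 i)))
               (sum-lower-bound (1 ℕ.+ 2 ℕ.* i) X (rows-lower-bound (x ∷ T) 1 l conds pos i X eX))

column-gaps-at : ∀ T → RowsConditions T → ∀ i X Y → at T (suc i) ≡ just X → at T (suc (suc i)) ≡ just Y → ColumnGaps X Y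
column-gaps-at (x ∷ y ∷ T) (((_ , column , _) , _)) zero X Y refl refl = column
column-gaps-at (x ∷ T) (_ , conds) (suc i) = column-gaps-at T conds i

sum-gap : ∀ X Y → ColumnGaps X Y → length X ≡ length Y → sumℕ X ℕ.+ 2 ℕ.* length X ℕ.≤ sumℕ Y
sum-gap [] [] _ _ = ℕ.z≤n
sum-gap (a ∷ xs) (b ∷ ys) column e =
  ℕP.≤-trans (ℕP.≤-reflexive (ring a (sumℕ xs) (length xs)))
    (ℕP.+-mono-≤ (column 1 a b refl refl)
      (sum-gap xs ys (λ { zero _ _ e _ → ⊥-elim (at-zero xs e) ; (suc j) → column (suc (suc j)) }) (ℕP.suc-injective e)))
  where
  ring : ∀ x s n → x ℕ.+ s ℕ.+ 2 ℕ.* (1 ℕ.+ n) ≡ (x ℕ.+ 2) ℕ.+ (s ℕ.+ 2 ℕ.* n)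
  ring = ℕSolver.solve-∀

framing-equal-rows : ∀ T → RowsConditions T → ∀ i m s s′ → at (map length T) i ≡ just m → at (map length T) (suc i) ≡ just m →
  at (map sumℕ T) i ≡ just s → at (map sumℕ T) (suc i) ≡ just s′ → s ℕ.+ 2 ℕ.* m ℕ.≤ s′
framing-equal-rows T _ zero _ _ _ e1 _ _ _ = ⊥-elim (at-zero (map length T) e1)
framing-equal-rows T conds (suc i) m s s′ e1 e2 e3 e4
  with at-map⁻ length T (suc i) e1 | at-map⁻ length T (suc (suc i)) e2
     | at-map⁻ sumℕ T (suc i) e3 | at-map⁻ sumℕ T (suc (suc i)) e4
... | X , eX , lX | Y , eY , lY | X′ , eX′ , refl | Y′ , eY′ , refl with trans (sym eX) eX′ | trans (sym eY) eY′
... | refl | refl = subst (λ k → sumℕ X ℕ.+ 2 ℕ.* k ℕ.≤ sumℕ Y) lX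
      (sum-gap X Y (column-gaps-at T conds i X Y eX eY) (trans lX (sym lY)))

mainTheorem7 : (μ : List ℕ) → IsPartition μ → (T : List (List ℕ)) → IsTableau μ T →
    IsFramed μ T ⇔ (ColumnStrict T × ColumnGap T × RowCondition T)
mainTheorem7 μ (_ , linked) T (refl , positive) = mk⇔ framed⇒conditions conditions⇒framed
  where
  framed⇒conditions : IsFramed (map length T) T → ColumnStrict T × ColumnGap T × RowCondition T
  framed⇒conditions (s , (same-length , _ , _) , fram≡T) =
    RowsConditions⇒ColumnStrict T conds , RowsConditions⇒ColumnGap T linked conds , RowsConditions⇒RowCondition T conds
    where
    admissible : AdmissibleRows (map (map toℤ) T)
    admissible = subst AdmissibleRows fram≡T (proj₁ (Fram-sound (map length T) s linked same-length))
    conds = AdmissibleRows⇒RowsConditions T admissible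
  conditions⇒framed : ColumnStrict T × ColumnGap T × RowCondition T → IsFramed (map length T) T
  conditions⇒framed (strict , gap , row) =
    map sumℕ T ,
    (length-map-sumℕ T , framing-rows T linked conds positive , framing-equal-rows T conds) ,
    Fram-complete T linked (RowsConditions⇒AdmissibleRows T conds)
    where
    conds = tableau⇒RowsConditions T strict gap row
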